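{- Let $A$ be a totally unimodular $n\times m$ matrix and let $\lambda := \lambda(L(A))$. Then every nonzero vector $v \in L(A)$ with $\|v\|_1 < 2\lambda$ is a circuit of $A$.
   Context: $L(A) := \{v \in \mathbb{Z}^m : Av = 0\}$ and $\lambda(L) := \min\{\|v\|_1 : 0\neq v \in L\}$. A vector $u \in L(A)$ is a circuit of $A$ if there is no nonzero $v \in L(A)$ with $\mathrm{supp}(v) \subsetneq \mathrm{supp}(u)$, and $\gcd(u_1, \dots, u_m) = 1$. A matrix is totally unimodular if every square submatrix has determinant $0$ or $\pm1$. -}

module Defs where

open import Data.Nat as ℕ using (ℕ; zero; suc)
open import Data.Nat.GCD using (gcd)
open import Data.Integer as ℤ using (ℤ; +_; -_; ∣_∣)
open import Data.Fin using (Fin; zero; suc; punchIn)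
open import Data.Product using (Σ; ∃; _×_; _,_)
open import Data.Sum using (_⊎_)
open import Relation.Binary.PropositionalEquality using (_≡_; _≢_)
open import Relation.Nullary using (¬_)
open import Function.Definitions using (Injective)

Matrix : ℕ → ℕ → Set
Matrix n m = Fin n → Fin m → ℤ

Vector : ℕ → Set
Vector m = Fin m → ℤ

sumℤ : ∀ {k} → (Fin k → ℤ) → ℤ
sumℤ {zero}  f = + 0
sumℤ {suc k} f = f zero ℤ.+ sumℤ (λ j → f (suc j))

sumℕ : ∀ {k} → (Fin k → ℕ) → ℕ
sumℕ {zero}  f = 0
sumℕ {suc k} f = f zero ℕ.+ sumℕ (λ j → f (suc j))

sign : ℕ → ℤ
sign zero          = + 1
sign (suc zero)    = - (+ 1)
sign (suc (suc k)) = sign k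

toℕ' : ∀ {k} → Fin k → ℕ
toℕ' zero    = 0
toℕ' (suc i) = suc (toℕ' i)

det : ∀ {k} → Matrix k k → ℤ
det {zero}  M = + 1
det {suc k} M =
  sumℤ (λ j → sign (toℕ' j) ℤ.* (M zero j ℤ.* det (λ a b → M (suc a) (punchIn j b))))

submatrix : ∀ {n m k} → Matrix n m → (Fin k → Fin n) → (Fin k → Fin m) → Matrix k k
submatrix A r c a b = A (r a) (c b)

TotallyUnimodular : ∀ {n m} → Matrix n m → Set
TotallyUnimodular {n} {m} A =
  ∀ (k : ℕ) (r : Fin k → Fin n) (c : Fin k → Fin m) →
  Injective _≡_ _≡_ r → Injective _≡_ _≡_ c →
  (det (submatrix A r c) ≡ + 0) ⊎ (det (submatrix A r c) ≡ + 1) ⊎ (det (submatrix A r c) ≡ - (+ 1))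

-- membership in the lattice L(A) = {v ∈ ℤ^m : A v = 0}
InL : ∀ {n m} → Matrix n m → Vector m → Set
InL A v = ∀ i → sumℤ (λ j → A i j ℤ.* v j) ≡ + 0

NonZero : ∀ {m} → Vector m → Set
NonZero v = ¬ (∀ j → v j ≡ + 0)

norm1 : ∀ {m} → Vector m → ℕ
norm1 v = sumℕ (λ j → ∣ v j ∣)

IsLambda : ∀ {n m} → Matrix n m → ℕ → Set
IsLambda A λ₀ =
  (∃ λ v → InL A v × NonZero v × norm1 v ≡ λ₀) ×
  (∀ v → InL A v → NonZero v → λ₀ ℕ.≤ norm1 v)

SuppStrictSub : ∀ {m} → Vector m → Vector m → Set
SuppStrictSub v u =
  (∀ j → v j ≢ + 0 → u j ≢ + 0) × (∃ λ j → u j ≢ + 0 × v j ≡ + 0)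

gcdVec : ∀ {m} → Vector m → ℕ
gcdVec {zero}  v = 0
gcdVec {suc m} v = gcd ∣ v zero ∣ (gcdVec (λ j → v (suc j)))

IsCircuit : ∀ {n m} → Matrix n m → Vector m → Set
IsCircuit A u =
  InL A u ×
  (¬ (∃ λ v → InL A v × NonZero v × SuppStrictSub v u)) ×
  gcdVec u ≡ 1

-- Circuits of a totally unimodular matrix are {0, ±1}-vectors. Pivoting on a unit entry preserves total
-- unimodularity, because every square submatrix of the pivoted matrix is the Schur complement of a square
-- submatrix of the original one; this allows an induction on the number of columns showing that a
-- support-minimal kernel vector has entries of constant modulus.
-- Now let v ∈ L(A) be nonzero with ‖v‖₁ < 2λ. Descending along supports, some support-minimal u₀ ∈ L(A) is
-- conformal to v, and its sign vector u lies in L(A). Then ‖u‖₁ + ‖v - u‖₁ = ‖v‖₁ < 2λ forces v = u, so v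
-- is support-minimal. If all entries of v were divisible by some g ≥ 2, then v / g ∈ L(A) would give
-- ‖v‖₁ ≥ 2λ; hence the entries of v are coprime.

module Submission where

open import Defs
open import Data.Product using (_,_)

module TUCircuits where
  open import Data.Nat as ℕ using (ℕ; zero; suc; z≤n; s≤s)
  open import Data.Nat.Divisibility using (_∣_; ∣-trans)
  open import Data.Nat.GCD using (gcd[m,n]∣m; gcd[m,n]∣n; gcd[m,n]≡0⇒m≡0; gcd[m,n]≡0⇒n≡0)
  import Data.Nat.Properties as ℕP
  open import Data.Integer using (ℤ; +_; -_; ∣_∣; +[1+_]; -[1+_]; _+_; _*_; _-_)
  import Data.Integer.Divisibility.Signed as Signed
  import Data.Integer.Properties as ℤP
  open import Data.Integer.Tactic.RingSolver using (solve-∀)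
  open import Data.Fin using (Fin; zero; suc; punchIn; punchOut; toℕ; inject₁)
  import Data.Fin.Properties as FinP
  open import Data.Product using (∃; _×_; _,_)
  open import Data.Sum as Sum using (_⊎_; inj₁; inj₂; [_,_]′)
  open import Data.Empty using (⊥-elim)
  open import Function using (_∘_; id)
  open import Function.Definitions using (Injective)
  open import Relation.Binary.PropositionalEquality
  open import Relation.Nullary using (¬_; Dec; yes; no)
  open import Relation.Nullary.Decidable using (¬?; _×-dec_; decidable-stable)
  open import Relation.Binary.Definitions using (tri<; tri≈; tri>)
  open import Data.Vec.Functional using (updateAt; insertAt; removeAt)
  open import Data.Vec.Functional.Properties
    using (updateAt-updates; updateAt-minimal; insertAt-lookup; insertAt-punchIn)
  open import Algebra.Properties.CommutativeSemigroup ℤP.+-commutativeSemigroup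
    using () renaming (interchange to +-interchange; x∙yz≈y∙xz to +-left-commute)
  open import Algebra.Properties.CommutativeSemigroup ℕP.+-commutativeSemigroup
    using () renaming (interchange to ℕ-+-interchange; x∙yz≈y∙xz to ℕ-+-left-commute)

  sumℤ-cong : ∀ {k} {f g : Fin k → ℤ} → (∀ j → f j ≡ g j) → sumℤ f ≡ sumℤ g
  sumℤ-cong {zero}  f≗g = refl
  sumℤ-cong {suc k} f≗g = cong₂ _+_ (f≗g zero) (sumℤ-cong (f≗g ∘ suc))

  sumℤ-zero : ∀ {k} {f : Fin k → ℤ} → (∀ j → f j ≡ + 0) → sumℤ f ≡ + 0
  sumℤ-zero {zero}  f≗0 = refl
  sumℤ-zero {suc k} f≗0 = cong₂ _+_ (f≗0 zero) (sumℤ-zero (f≗0 ∘ suc))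

  sumℤ-+ : ∀ {k} (f g : Fin k → ℤ) → sumℤ (λ j → f j + g j) ≡ sumℤ f + sumℤ g
  sumℤ-+ {zero}  f g = refl
  sumℤ-+ {suc k} f g = trans (cong (_+_ (f zero + g zero)) (sumℤ-+ (f ∘ suc) (g ∘ suc)))
    (+-interchange (f zero) (g zero) (sumℤ (f ∘ suc)) (sumℤ (g ∘ suc)))

  sumℤ-*ˡ : ∀ {k} c (f : Fin k → ℤ) → sumℤ (λ j → c * f j) ≡ c * sumℤ f
  sumℤ-*ˡ {zero}  c f = sym (ℤP.*-zeroʳ c)
  sumℤ-*ˡ {suc k} c f = trans (cong (_+_ (c * f zero)) (sumℤ-*ˡ c (f ∘ suc)))
    (sym (ℤP.*-distribˡ-+ c (f zero) (sumℤ (f ∘ suc))))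

  sumℤ-neg : ∀ {k} (f : Fin k → ℤ) → sumℤ (λ j → - f j) ≡ - sumℤ f
  sumℤ-neg {zero}  f = refl
  sumℤ-neg {suc k} f = trans (cong (_+_ (- f zero)) (sumℤ-neg (f ∘ suc)))
    (sym (ℤP.neg-distrib-+ (f zero) (sumℤ (f ∘ suc))))

  sumℤ-lincomb : ∀ {k} a b (f g : Fin k → ℤ) →
    sumℤ (λ j → a * f j + b * g j) ≡ a * sumℤ f + b * sumℤ g
  sumℤ-lincomb a b f g =
    trans (sumℤ-+ (λ j → a * f j) (λ j → b * g j)) (cong₂ _+_ (sumℤ-*ˡ a f) (sumℤ-*ˡ b g))

  sumℤ-remove : ∀ {k} (i : Fin (suc k)) (f : Fin (suc k) → ℤ) →
    sumℤ f ≡ f i + sumℤ (f ∘ punchIn i)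
  sumℤ-remove zero          f = refl
  sumℤ-remove {suc k} (suc i) f = trans (cong (_+_ (f zero)) (sumℤ-remove i (f ∘ suc)))
    (+-left-commute (f zero) (f (suc i)) (sumℤ (f ∘ suc ∘ punchIn i)))

  sumℤ-pair : ∀ {m} (i j : Fin m) → i ≢ j → (∀ q → q ≡ i ⊎ q ≡ j) →
    (f : Fin m → ℤ) → sumℤ f ≡ f i + f j
  sumℤ-pair {suc zero}    zero zero i≢j only-i-j f = ⊥-elim (i≢j refl)
  sumℤ-pair {suc (suc m)} i    j    i≢j only-i-j f = trans (sumℤ-remove i f) (cong (_+_ (f i)) rest≡fj)
    where
    j′ = punchOut i≢j
    others≡0 : ∀ c → f (punchIn i (punchIn j′ c)) ≡ + 0
    others≡0 c with only-i-j (punchIn i (punchIn j′ c))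
    ... | inj₁ e = ⊥-elim (FinP.punchInᵢ≢i i _ e)
    ... | inj₂ e = ⊥-elim (FinP.punchInᵢ≢i j′ c
                     (FinP.punchIn-injective i _ _ (trans e (sym (FinP.punchIn-punchOut i≢j)))))
    rest≡fj : sumℤ (f ∘ punchIn i) ≡ f j
    rest≡fj = trans (sumℤ-remove j′ (f ∘ punchIn i))
      (trans (cong₂ _+_ (cong f (FinP.punchIn-punchOut i≢j)) (sumℤ-zero others≡0)) (ℤP.+-identityʳ (f j)))

  sumℤ-insertAt : ∀ {m} (w : Fin (suc m) → ℤ) (y : Vector m) q t →
    sumℤ (λ j → w j * insertAt y q t j) ≡ w q * t + sumℤ (λ b → w (punchIn q b) * y b)
  sumℤ-insertAt w y q t = trans (sumℤ-remove q (λ j → w j * insertAt y q t j))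
    (cong₂ _+_ (cong (w q *_) (insertAt-lookup y q t))
               (sumℤ-cong (λ b → cong (w (punchIn q b) *_) (insertAt-punchIn y q t b))))

  sumℕ-cong : ∀ {k} {f g : Fin k → ℕ} → (∀ j → f j ≡ g j) → sumℕ f ≡ sumℕ g
  sumℕ-cong {zero}  f≗g = refl
  sumℕ-cong {suc k} f≗g = cong₂ ℕ._+_ (f≗g zero) (sumℕ-cong (f≗g ∘ suc))

  sumℕ-+ : ∀ {k} (f g : Fin k → ℕ) → sumℕ (λ j → f j ℕ.+ g j) ≡ sumℕ f ℕ.+ sumℕ g
  sumℕ-+ {zero}  f g = refl
  sumℕ-+ {suc k} f g = trans (cong (f zero ℕ.+ g zero ℕ.+_) (sumℕ-+ (f ∘ suc) (g ∘ suc)))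
    (ℕ-+-interchange (f zero) (g zero) (sumℕ (f ∘ suc)) (sumℕ (g ∘ suc)))

  sumℕ-*ˡ : ∀ {k} c (f : Fin k → ℕ) → sumℕ (λ j → c ℕ.* f j) ≡ c ℕ.* sumℕ f
  sumℕ-*ˡ {zero}  c f = sym (ℕP.*-zeroʳ c)
  sumℕ-*ˡ {suc k} c f = trans (cong (c ℕ.* f zero ℕ.+_) (sumℕ-*ˡ c (f ∘ suc)))
    (sym (ℕP.*-distribˡ-+ c (f zero) (sumℕ (f ∘ suc))))

  sumℕ-mono-≤ : ∀ {k} {f g : Fin k → ℕ} → (∀ j → f j ℕ.≤ g j) → sumℕ f ℕ.≤ sumℕ g
  sumℕ-mono-≤ {zero}  f≤g = z≤n
  sumℕ-mono-≤ {suc k} f≤g = ℕP.+-mono-≤ (f≤g zero) (sumℕ-mono-≤ (f≤g ∘ suc))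

  sumℕ-remove : ∀ {k} (i : Fin (suc k)) (f : Fin (suc k) → ℕ) →
    sumℕ f ≡ f i ℕ.+ sumℕ (f ∘ punchIn i)
  sumℕ-remove zero            f = refl
  sumℕ-remove {suc k} (suc i) f = trans (cong (f zero ℕ.+_) (sumℕ-remove i (f ∘ suc)))
    (ℕ-+-left-commute (f zero) (f (suc i)) (sumℕ (λ j → f (suc (punchIn i j)))))

  sumℕ≡0⇒≡0 : ∀ {k} (f : Fin k → ℕ) → sumℕ f ≡ 0 → ∀ j → f j ≡ 0
  sumℕ≡0⇒≡0 {suc k} f sum≡0 zero    = ℕP.m+n≡0⇒m≡0 (f zero) sum≡0
  sumℕ≡0⇒≡0 {suc k} f sum≡0 (suc j) = sumℕ≡0⇒≡0 (f ∘ suc) (ℕP.m+n≡0⇒n≡0 (f zero) sum≡0) j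

  punchIn-cases : ∀ {m} (q j : Fin (suc m)) → j ≡ q ⊎ ∃ λ b → j ≡ punchIn q b
  punchIn-cases q j with q FinP.≟ j
  ... | yes q≡j = inj₁ (sym q≡j)
  ... | no q≢j  = inj₂ (punchOut q≢j , sym (FinP.punchIn-punchOut q≢j))

  no-third⇒only-two : ∀ {m} (i j : Fin m) → ¬ (∃ λ q → q ≢ i × q ≢ j) → ∀ q → q ≡ i ⊎ q ≡ j
  no-third⇒only-two i j ∄third q with q FinP.≟ i | q FinP.≟ j
  ... | yes q≡i | _       = inj₁ q≡i
  ... | no _    | yes q≡j = inj₂ q≡j
  ... | no q≢i  | no q≢j  = ⊥-elim (∄third (q , q≢i , q≢j))

  minimal-element : ∀ {m} {P : Fin m → Set} → (∀ i → Dec (P i)) → (R : Fin m → Fin m → Set) →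
    (∀ i j → R i j ⊎ R j i) → (∀ {i j k} → P i → P j → P k → R i j → R j k → R i k) →
    ∃ P → ∃ λ i → P i × (∀ j → P j → R i j)
  minimal-element {suc m} {P} P? R total R-trans ∃P with FinP.any? (P? ∘ suc)
  ... | no ∄tail = zero , P0 , λ { zero _ → R-refl zero ; (suc j) Pj → ⊥-elim (∄tail (j , Pj)) }
    where
    R-refl : ∀ i → R i i
    R-refl i = [ id , id ]′ (total i i)
    P0 : P zero
    P0 = at-zero ∃P
      where
      at-zero : ∃ P → P zero
      at-zero (zero  , P0) = P0
      at-zero (suc i , Pi) = ⊥-elim (∄tail (i , Pi))
  ... | yes ∃tail
    with minimal-element (P? ∘ suc) (λ i j → R (suc i) (suc j)) (λ i j → total (suc i) (suc j))
                         R-trans ∃tail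
  ...   | i₁ , Pi₁ , i₁-min with P? zero
  ...     | no ¬P0 = suc i₁ , Pi₁ , λ { zero P0 → ⊥-elim (¬P0 P0) ; (suc j) Pj → i₁-min j Pj }
  ...     | yes P0 with total zero (suc i₁)
  ...       | inj₂ Ri₁0 = suc i₁ , Pi₁ , λ { zero _ → Ri₁0 ; (suc j) Pj → i₁-min j Pj }
  ...       | inj₁ R0i₁ = zero , P0 , λ { zero _ → [ id , id ]′ (total zero zero)
                                         ; (suc j) Pj → R-trans P0 Pi₁ Pj R0i₁ (i₁-min j Pj) }

  -- Xi/Yi ≤ Xj/Yj ≤ Xk/Yk in cross-multiplied form; the middle denominator Yj must be positive.
  cross-≤-trans : ∀ Xi Xj Xk Yi Yk w → Xi ℕ.* suc w ℕ.≤ Xj ℕ.* Yi → Xj ℕ.* Yk ℕ.≤ Xk ℕ.* suc w →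
    Xi ℕ.* Yk ℕ.≤ Xk ℕ.* Yi
  cross-≤-trans Xi Xj Xk Yi Yk w h₁ h₂ = ℕP.*-cancelʳ-≤ (Xi ℕ.* Yk) (Xk ℕ.* Yi) (suc w) (begin
    Xi ℕ.* Yk ℕ.* suc w   ≡⟨ swap-last Xi Yk (suc w) ⟩
    Xi ℕ.* suc w ℕ.* Yk   ≤⟨ ℕP.*-monoˡ-≤ Yk h₁ ⟩
    Xj ℕ.* Yi ℕ.* Yk      ≡⟨ swap-last Xj Yi Yk ⟩
    Xj ℕ.* Yk ℕ.* Yi      ≤⟨ ℕP.*-monoˡ-≤ Yi h₂ ⟩
    Xk ℕ.* suc w ℕ.* Yi   ≡⟨ swap-last Xk (suc w) Yi ⟩
    Xk ℕ.* Yi ℕ.* suc w   ∎)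
    where
    open ℕP.≤-Reasoning
    swap-last : ∀ a b c → a ℕ.* b ℕ.* c ≡ a ℕ.* c ℕ.* b
    swap-last a b c =
      trans (ℕP.*-assoc a b c) (trans (cong (a ℕ.*_) (ℕP.*-comm b c)) (sym (ℕP.*-assoc a c b)))

  -- Determinants

  minor : ∀ {k} → Matrix (suc k) (suc k) → Fin (suc k) → Matrix k k
  minor M j a b = M (suc a) (punchIn j b)

  laplaceTerm : ∀ {k} → Matrix (suc k) (suc k) → Fin (suc k) → ℤ
  laplaceTerm M j = sign (toℕ' j) * (M zero j * det (minor M j))

  det-cong : ∀ {k} {M N : Matrix k k} → (∀ a b → M a b ≡ N a b) → det M ≡ det N
  det-cong {zero}  M≗N = refl
  det-cong {suc k} M≗N = sumℤ-cong λ j → cong₂ (λ x y → sign (toℕ' j) * (x * y))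
    (M≗N zero j) (det-cong (λ a b → M≗N (suc a) (punchIn j b)))

  det-linear-column : ∀ {k} (j : Fin k) (t : ℤ) (M₁ M₂ M : Matrix k k) →
    (∀ a c → c ≢ j → M a c ≡ M₁ a c) → (∀ a c → c ≢ j → M a c ≡ M₂ a c) →
    (∀ a → M a j ≡ M₁ a j + t * M₂ a j) → det M ≡ det M₁ + t * det M₂
  det-linear-column {suc k} j t M₁ M₂ M off₁ off₂ on = begin
    sumℤ (laplaceTerm M)
      ≡⟨ sumℤ-cong term ⟩
    sumℤ (λ c → laplaceTerm M₁ c + t * laplaceTerm M₂ c)
      ≡⟨ sumℤ-+ (laplaceTerm M₁) (λ c → t * laplaceTerm M₂ c) ⟩
    sumℤ (laplaceTerm M₁) + sumℤ (λ c → t * laplaceTerm M₂ c)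
      ≡⟨ cong (_+_ (sumℤ (laplaceTerm M₁))) (sumℤ-*ˡ t (laplaceTerm M₂)) ⟩
    sumℤ (laplaceTerm M₁) + t * sumℤ (laplaceTerm M₂)
      ∎
    where
    open ≡-Reasoning
    term : ∀ c → laplaceTerm M c ≡ laplaceTerm M₁ c + t * laplaceTerm M₂ c
    term c with c FinP.≟ j
    ... | yes refl = trans (cong₂ (λ x y → sign (toℕ' c) * (x * y)) (on zero) minor≡₁)
                           (trans (expand (sign (toℕ' c)) (M₁ zero c) (M₂ zero c) t _)
                                  (cong (λ D → laplaceTerm M₁ c + t * (sign (toℕ' c) * (M₂ zero c * D)))
                                        (trans (sym minor≡₁) minor≡₂)))
      where
      minor≡₁ : det (minor M c) ≡ det (minor M₁ c)
      minor≡₁ = det-cong (λ a b → off₁ (suc a) (punchIn c b) (FinP.punchInᵢ≢i c b))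
      minor≡₂ : det (minor M c) ≡ det (minor M₂ c)
      minor≡₂ = det-cong (λ a b → off₂ (suc a) (punchIn c b) (FinP.punchInᵢ≢i c b))
      expand : ∀ s m₁ m₂ t D → s * ((m₁ + t * m₂) * D) ≡ s * (m₁ * D) + t * (s * (m₂ * D))
      expand = solve-∀
    ... | no c≢j = trans (cong₂ (λ x y → sign (toℕ' c) * (x * y)) (off₁ zero c c≢j) minor-linear)
                         (trans (expand (sign (toℕ' c)) (M₁ zero c) _ _ t)
                                (cong (λ x → laplaceTerm M₁ c + t * (sign (toℕ' c) * (x * det (minor M₂ c))))
                                      (trans (sym (off₁ zero c c≢j)) (off₂ zero c c≢j))))
      where
      j′ = punchOut c≢j
      punchIn-j′ : punchIn c j′ ≡ j
      punchIn-j′ = FinP.punchIn-punchOut c≢j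
      avoids-j : ∀ b → b ≢ j′ → punchIn c b ≢ j
      avoids-j b b≢j′ e = b≢j′ (FinP.punchIn-injective c b j′ (trans e (sym punchIn-j′)))
      minor-linear : det (minor M c) ≡ det (minor M₁ c) + t * det (minor M₂ c)
      minor-linear = det-linear-column j′ t (minor M₁ c) (minor M₂ c) (minor M c)
        (λ a b b≢j′ → off₁ (suc a) (punchIn c b) (avoids-j b b≢j′))
        (λ a b b≢j′ → off₂ (suc a) (punchIn c b) (avoids-j b b≢j′))
        (λ a → subst (λ z → M (suc a) z ≡ M₁ (suc a) z + t * M₂ (suc a) z)
                     (sym punchIn-j′) (on (suc a)))
      expand : ∀ s m D₁ D₂ t → s * (m * (D₁ + t * D₂)) ≡ s * (m * D₁) + t * (s * (m * D₂))
      expand = solve-∀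

  adjSwap : ∀ {k} → Fin k → Fin (suc k) → Fin (suc k)
  adjSwap zero    zero          = suc zero
  adjSwap zero    (suc zero)    = zero
  adjSwap zero    (suc (suc c)) = suc (suc c)
  adjSwap (suc b) zero          = zero
  adjSwap (suc b) (suc c)       = suc (adjSwap b c)

  adjSwap-cases : ∀ {k} (b : Fin k) c → adjSwap b c ≡ c ⊎
    (c ≡ inject₁ b × adjSwap b c ≡ suc b) ⊎ (c ≡ suc b × adjSwap b c ≡ inject₁ b)
  adjSwap-cases zero    zero          = inj₂ (inj₁ (refl , refl))
  adjSwap-cases zero    (suc zero)    = inj₂ (inj₂ (refl , refl))
  adjSwap-cases zero    (suc (suc c)) = inj₁ refl
  adjSwap-cases (suc b) zero          = inj₁ refl
  adjSwap-cases (suc b) (suc c) with adjSwap-cases b c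
  ... | inj₁ e                 = inj₁ (cong suc e)
  ... | inj₂ (inj₁ (e₁ , e₂)) = inj₂ (inj₁ (cong suc e₁ , cong suc e₂))
  ... | inj₂ (inj₂ (e₁ , e₂)) = inj₂ (inj₂ (cong suc e₁ , cong suc e₂))

  adjSwap-inject₁ : ∀ {k} (b : Fin k) → adjSwap b (inject₁ b) ≡ suc b
  adjSwap-inject₁ zero    = refl
  adjSwap-inject₁ (suc b) = cong suc (adjSwap-inject₁ b)

  adjSwap-below : ∀ {k} (b : Fin k) (c : Fin (suc k)) → toℕ c ℕ.< toℕ b → adjSwap b c ≡ c
  adjSwap-below (suc b) zero    c<b       = refl
  adjSwap-below (suc b) (suc c) (s≤s c<b) = cong suc (adjSwap-below b c c<b)

  adjSwap-punchIn-moved : ∀ {k} (b : Fin k) (c : Fin (suc k)) → adjSwap b c ≢ c →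
    ∀ d → adjSwap b (punchIn c d) ≡ punchIn (adjSwap b c) d
  adjSwap-punchIn-moved zero    zero          moved zero    = refl
  adjSwap-punchIn-moved zero    zero          moved (suc d) = refl
  adjSwap-punchIn-moved zero    (suc zero)    moved zero    = refl
  adjSwap-punchIn-moved zero    (suc zero)    moved (suc d) = refl
  adjSwap-punchIn-moved zero    (suc (suc c)) moved d       = ⊥-elim (moved refl)
  adjSwap-punchIn-moved (suc b) zero          moved d       = ⊥-elim (moved refl)
  adjSwap-punchIn-moved (suc b) (suc c)       moved zero    = refl
  adjSwap-punchIn-moved (suc b) (suc c)       moved (suc d) =
    cong suc (adjSwap-punchIn-moved b c (moved ∘ cong suc) d)

  adjSwap-punchIn-fixed : ∀ {k} (b : Fin (suc k)) (c : Fin (suc (suc k))) → adjSwap b c ≡ c →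
    ∃ λ b′ → ∀ d → adjSwap b (punchIn c d) ≡ punchIn c (adjSwap b′ d)
  adjSwap-punchIn-fixed zero (suc zero) ()
  adjSwap-punchIn-fixed {suc k} zero (suc (suc c)) fixed = zero , swap₀₁
    where
    swap₀₁ : ∀ d → adjSwap zero (punchIn (suc (suc c)) d) ≡ punchIn (suc (suc c)) (adjSwap zero d)
    swap₀₁ zero          = refl
    swap₀₁ (suc zero)    = refl
    swap₀₁ (suc (suc d)) = refl
  adjSwap-punchIn-fixed (suc b) zero fixed = b , λ d → refl
  adjSwap-punchIn-fixed {suc k} (suc b) (suc c) fixed with adjSwap-punchIn-fixed b c (FinP.suc-injective fixed)
  ... | b′ , commutes = suc b′ , commutes′
    where
    commutes′ : ∀ d → adjSwap (suc b) (punchIn (suc c) d) ≡ punchIn (suc c) (adjSwap (suc b′) d)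
    commutes′ zero    = refl
    commutes′ (suc d) = cong suc (commutes d)

  toℕ'-adjSwap : ∀ {k} (b : Fin k) (c : Fin (suc k)) → adjSwap b c ≢ c →
    toℕ' (adjSwap b c) ≡ suc (toℕ' c) ⊎ toℕ' c ≡ suc (toℕ' (adjSwap b c))
  toℕ'-adjSwap zero    zero          moved = inj₁ refl
  toℕ'-adjSwap zero    (suc zero)    moved = inj₂ refl
  toℕ'-adjSwap zero    (suc (suc c)) moved = ⊥-elim (moved refl)
  toℕ'-adjSwap (suc b) zero          moved = ⊥-elim (moved refl)
  toℕ'-adjSwap (suc b) (suc c)       moved with toℕ'-adjSwap b c (moved ∘ cong suc)
  ... | inj₁ e = inj₁ (cong suc e)
  ... | inj₂ e = inj₂ (cong suc e)

  sign-suc : ∀ n → sign (suc n) ≡ - sign n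
  sign-suc zero          = refl
  sign-suc (suc zero)    = refl
  sign-suc (suc (suc n)) = sign-suc n

  sign-adjSwap : ∀ {k} (b : Fin k) (c : Fin (suc k)) → adjSwap b c ≢ c →
    sign (toℕ' (adjSwap b c)) ≡ - sign (toℕ' c)
  sign-adjSwap b c moved with toℕ'-adjSwap b c moved
  ... | inj₁ e rewrite e = sign-suc (toℕ' c)
  ... | inj₂ e rewrite e | sign-suc (toℕ' (adjSwap b c)) = sym (ℤP.neg-involutive _)

  sumℤ-adjSwap : ∀ {k} (b : Fin k) (f : Fin (suc k) → ℤ) → sumℤ (f ∘ adjSwap b) ≡ sumℤ f
  sumℤ-adjSwap zero    f = +-left-commute (f (suc zero)) (f zero) (sumℤ (λ j → f (suc (suc j))))
  sumℤ-adjSwap (suc b) f = cong (_+_ (f zero)) (sumℤ-adjSwap b (f ∘ suc))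

  det-adjSwap : ∀ {k} (b : Fin k) (M M′ : Matrix (suc k) (suc k)) →
    (∀ a c → M′ a c ≡ M a (adjSwap b c)) → det M′ ≡ - det M
  det-adjSwap {suc k} b M M′ M′≗M∘swap = begin
    sumℤ (laplaceTerm M′)                      ≡⟨ sumℤ-cong term ⟩
    sumℤ (λ c → - laplaceTerm M (adjSwap b c)) ≡⟨ sumℤ-neg (laplaceTerm M ∘ adjSwap b) ⟩
    - sumℤ (laplaceTerm M ∘ adjSwap b)         ≡⟨ cong -_ (sumℤ-adjSwap b (laplaceTerm M)) ⟩
    - sumℤ (laplaceTerm M)                     ∎
    where
    open ≡-Reasoning
    term : ∀ c → laplaceTerm M′ c ≡ - laplaceTerm M (adjSwap b c)
    term c with adjSwap b c FinP.≟ c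
    ... | no moved = begin
      sign (toℕ' c) * (M′ zero c * det (minor M′ c))
        ≡⟨ cong₂ (λ x y → sign (toℕ' c) * (x * y)) (M′≗M∘swap zero c)
                 (det-cong (λ a d → trans (M′≗M∘swap (suc a) (punchIn c d))
                                          (cong (M (suc a)) (adjSwap-punchIn-moved b c moved d)))) ⟩
      sign (toℕ' c) * (M zero c′ * det (minor M c′))
        ≡⟨ cong (_* (M zero c′ * det (minor M c′)))
                (trans (sym (ℤP.neg-involutive _)) (cong -_ (sym (sign-adjSwap b c moved)))) ⟩
      - sign (toℕ' c′) * (M zero c′ * det (minor M c′))
        ≡⟨ sym (ℤP.neg-distribˡ-* (sign (toℕ' c′)) _) ⟩
      - laplaceTerm M c′ ∎
      where
      c′ = adjSwap b c
    ... | yes fixed with adjSwap-punchIn-fixed b c fixed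
    ...   | b′ , commutes = begin
      sign (toℕ' c) * (M′ zero c * det (minor M′ c))
        ≡⟨ cong₂ (λ x y → sign (toℕ' c) * (x * y)) (trans (M′≗M∘swap zero c) (cong (M zero) fixed))
                 (det-adjSwap b′ (minor M c) (minor M′ c)
                    (λ a d → trans (M′≗M∘swap (suc a) (punchIn c d)) (cong (M (suc a)) (commutes d)))) ⟩
      sign (toℕ' c) * (M zero c * - det (minor M c))
        ≡⟨ cong (sign (toℕ' c) *_) (sym (ℤP.neg-distribʳ-* (M zero c) _)) ⟩
      sign (toℕ' c) * - (M zero c * det (minor M c))
        ≡⟨ sym (ℤP.neg-distribʳ-* (sign (toℕ' c)) _) ⟩
      - laplaceTerm M c
        ≡⟨ cong (-_ ∘ laplaceTerm M) (sym fixed) ⟩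
      - laplaceTerm M (adjSwap b c) ∎

  self-negating : ∀ x → x ≡ - x → x ≡ + 0
  self-negating (+ zero) _ = refl

  det-adjacent-equal-columns : ∀ {k} (b : Fin k) (M : Matrix (suc k) (suc k)) →
    (∀ a → M a (inject₁ b) ≡ M a (suc b)) → det M ≡ + 0
  det-adjacent-equal-columns b M equal = self-negating (det M) (det-adjSwap b M M swap-invariant)
    where
    swap-invariant : ∀ a c → M a c ≡ M a (adjSwap b c)
    swap-invariant a c with adjSwap-cases b c
    ... | inj₁ e                                 = cong (M a) (sym e)
    ... | inj₂ (inj₁ (e₁ , e₂)) rewrite e₁ | e₂ = equal a
    ... | inj₂ (inj₂ (e₁ , e₂)) rewrite e₁ | e₂ = sym (equal a)

  -- Induction on the distance d between the equal columns, moving the right one leftwards by adjSwap.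
  det-equal-columns-apart : ∀ d {k} (M : Matrix (suc k) (suc k)) (z : Fin (suc k)) (b : Fin k) →
    toℕ b ≡ toℕ z ℕ.+ d → (∀ a → M a z ≡ M a (suc b)) → det M ≡ + 0
  det-equal-columns-apart zero M z b b≡z equal =
    det-adjacent-equal-columns b M (λ a → trans (cong (M a) inject₁b≡z) (equal a))
    where
    inject₁b≡z : inject₁ b ≡ z
    inject₁b≡z = FinP.toℕ-injective (trans (FinP.toℕ-inject₁ b) (trans b≡z (ℕP.+-identityʳ _)))
  det-equal-columns-apart (suc d) M z zero b≡z+d+1 equal =
    ⊥-elim (ℕP.0≢1+n (trans b≡z+d+1 (ℕP.+-suc (toℕ z) d)))
  det-equal-columns-apart (suc d) {suc k} M z (suc b) b+1≡z+d+1 equal = begin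
    det M        ≡⟨ sym (ℤP.neg-involutive (det M)) ⟩
    - - det M    ≡⟨ cong -_ (sym (det-adjSwap (suc b) M M′ (λ a c → refl))) ⟩
    - det M′     ≡⟨ cong -_ M′-singular ⟩
    + 0          ∎
    where
    open ≡-Reasoning
    M′ : Matrix (suc (suc k)) (suc (suc k))
    M′ a c = M a (adjSwap (suc b) c)
    b≡z+d : toℕ b ≡ toℕ z ℕ.+ d
    b≡z+d = ℕP.suc-injective (trans b+1≡z+d+1 (ℕP.+-suc (toℕ z) d))
    z<b+1 : toℕ z ℕ.< toℕ (suc b)
    z<b+1 = s≤s (subst (toℕ z ℕ.≤_) (sym b≡z+d) (ℕP.m≤m+n (toℕ z) d))
    M′-singular : det M′ ≡ + 0
    M′-singular = det-equal-columns-apart d M′ z (inject₁ b)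
      (trans (FinP.toℕ-inject₁ b) b≡z+d)
      (λ a → trans (cong (M a) (adjSwap-below (suc b) z z<b+1))
                   (trans (equal a) (cong (M a) (sym (adjSwap-inject₁ (suc b))))))

  det-equal-columns-< : ∀ {k} (M : Matrix k k) (z j : Fin k) → toℕ z ℕ.< toℕ j →
    (∀ a → M a z ≡ M a j) → det M ≡ + 0
  det-equal-columns-< {suc k} M z (suc b) (s≤s z≤b) =
    det-equal-columns-apart (toℕ b ℕ.∸ toℕ z) M z b (sym (ℕP.m+[n∸m]≡n z≤b))

  det-equal-columns : ∀ {k} (M : Matrix k k) (z j : Fin k) → z ≢ j →
    (∀ a → M a z ≡ M a j) → det M ≡ + 0
  det-equal-columns M z j z≢j equal with ℕP.<-cmp (toℕ z) (toℕ j)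
  ... | tri< z<j _ _ = det-equal-columns-< M z j z<j equal
  ... | tri≈ _ z≡j _ = ⊥-elim (z≢j (FinP.toℕ-injective z≡j))
  ... | tri> _ _ j<z = det-equal-columns-< M j z j<z (sym ∘ equal)

  det-add-column-multiple : ∀ {k} (M M′ : Matrix k k) (z j : Fin k) (t : ℤ) → z ≢ j →
    (∀ a c → c ≢ j → M′ a c ≡ M a c) → (∀ a → M′ a j ≡ M a j + t * M a z) → det M′ ≡ det M
  det-add-column-multiple M M′ z j t z≢j off on = begin
    det M′                  ≡⟨ det-linear-column j t M M-zj M′ off off-zj on-zj ⟩
    det M + t * det M-zj    ≡⟨ cong (λ D → det M + t * D) M-zj-singular ⟩
    det M + t * + 0         ≡⟨ cong (_+_ (det M)) (ℤP.*-zeroʳ t) ⟩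
    det M + + 0             ≡⟨ ℤP.+-identityʳ (det M) ⟩
    det M                   ∎
    where
    open ≡-Reasoning
    M-zj : Matrix _ _
    M-zj a = updateAt (M a) j (λ _ → M a z)
    off-zj : ∀ a c → c ≢ j → M′ a c ≡ M-zj a c
    off-zj a c c≢j = trans (off a c c≢j) (sym (updateAt-minimal c j (M a) c≢j))
    on-zj : ∀ a → M′ a j ≡ M a j + t * M-zj a j
    on-zj a = trans (on a) (cong (λ x → M a j + t * x) (sym (updateAt-updates j (M a))))
    M-zj-singular : det M-zj ≡ + 0
    M-zj-singular = det-equal-columns M-zj z j z≢j
      (λ a → trans (updateAt-minimal z j (M a) z≢j) (sym (updateAt-updates j (M a))))

  addColumn₀Multiples : ∀ {k} → Matrix (suc k) (suc k) → (Fin k → ℤ) → Matrix (suc k) (suc k)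
  addColumn₀Multiples M h a zero    = M a zero
  addColumn₀Multiples M h a (suc c) = M a (suc c) + M a zero * h c

  -- Induction on ℓ: the multiplier at position ℓ is undone by one column operation.
  det-addColumn₀Multiples-below : ∀ ℓ {k} (M : Matrix (suc k) (suc k)) (h : Fin k → ℤ) →
    (∀ c → ℓ ℕ.≤ toℕ c → h c ≡ + 0) → det (addColumn₀Multiples M h) ≡ det M
  det-addColumn₀Multiples-below zero M h h≡0 = det-cong unchanged
    where
    unchanged : ∀ a c → addColumn₀Multiples M h a c ≡ M a c
    unchanged a zero    = refl
    unchanged a (suc c) = trans (cong (λ x → M a (suc c) + M a zero * x) (h≡0 c z≤n))
                                (trans (cong (_+_ (M a (suc c))) (ℤP.*-zeroʳ (M a zero))) (ℤP.+-identityʳ _))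
  det-addColumn₀Multiples-below (suc ℓ) {k} M h h≡0 with FinP.any? (λ (c : Fin k) → toℕ c ℕP.≟ ℓ)
  ... | no ∄c = det-addColumn₀Multiples-below ℓ M h h≡0′
    where
    h≡0′ : ∀ c → ℓ ℕ.≤ toℕ c → h c ≡ + 0
    h≡0′ c ℓ≤c with ℕP.m≤n⇒m<n∨m≡n ℓ≤c
    ... | inj₁ ℓ<c = h≡0 c ℓ<c
    ... | inj₂ ℓ≡c = ⊥-elim (∄c (c , sym ℓ≡c))
  ... | yes (c* , c*≡ℓ) = trans (det-add-column-multiple (addColumn₀Multiples M h′) (addColumn₀Multiples M h)
                                    zero (suc c*) (h c*) (λ ()) off on)
                                (det-addColumn₀Multiples-below ℓ M h′ h′≡0)
    where
    h′ : Fin k → ℤ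
    h′ = updateAt h c* (λ _ → + 0)
    h′≡0 : ∀ c → ℓ ℕ.≤ toℕ c → h′ c ≡ + 0
    h′≡0 c ℓ≤c with c FinP.≟ c*
    ... | yes refl = updateAt-updates c* h
    ... | no c≢c* with ℕP.m≤n⇒m<n∨m≡n ℓ≤c
    ...   | inj₁ ℓ<c = trans (updateAt-minimal c c* h c≢c*) (h≡0 c ℓ<c)
    ...   | inj₂ ℓ≡c = ⊥-elim (c≢c* (FinP.toℕ-injective (trans (sym ℓ≡c) (sym c*≡ℓ))))
    off : ∀ a c → c ≢ suc c* → addColumn₀Multiples M h a c ≡ addColumn₀Multiples M h′ a c
    off a zero    _      = refl
    off a (suc c) c≢c*+1 =
      cong (λ x → M a (suc c) + M a zero * x) (sym (updateAt-minimal c c* h (c≢c*+1 ∘ cong suc)))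
    on : ∀ a → addColumn₀Multiples M h a (suc c*) ≡
               addColumn₀Multiples M h′ a (suc c*) + h c* * addColumn₀Multiples M h′ a zero
    on a = trans (shift (M a (suc c*)) (M a zero) (h c*))
      (cong (λ x → (M a (suc c*) + M a zero * x) + h c* * M a zero) (sym (updateAt-updates c* h)))
      where
      shift : ∀ x y t → x + y * t ≡ (x + y * + 0) + t * y
      shift = solve-∀

  det-addColumn₀Multiples : ∀ {k} (M : Matrix (suc k) (suc k)) (h : Fin k → ℤ) →
    det (addColumn₀Multiples M h) ≡ det M
  det-addColumn₀Multiples {k} M h =
    det-addColumn₀Multiples-below k M h (λ c k≤c → ⊥-elim (ℕP.<⇒≱ (FinP.toℕ<n c) k≤c))

  det-first-row-cleared : ∀ {k} (M : Matrix (suc k) (suc k)) → (∀ c → M zero (suc c) ≡ + 0) →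
    det M ≡ M zero zero * det (minor M zero)
  det-first-row-cleared M row₀≡0 = begin
    det M
      ≡⟨⟩
    + 1 * (M zero zero * det (minor M zero)) + sumℤ (laplaceTerm M ∘ suc)
      ≡⟨ cong₂ _+_ (ℤP.*-identityˡ (M zero zero * det (minor M zero))) (sumℤ-zero vanishes) ⟩
    M zero zero * det (minor M zero) + + 0
      ≡⟨ ℤP.+-identityʳ _ ⟩
    M zero zero * det (minor M zero)
      ∎
    where
    open ≡-Reasoning
    vanishes : ∀ c → laplaceTerm M (suc c) ≡ + 0
    vanishes c = trans (cong (λ x → sign (toℕ' (suc c)) * (x * det (minor M (suc c)))) (row₀≡0 c))
                       (ℤP.*-zeroʳ (sign (toℕ' (suc c))))

  IsUnit : ℤ → Set
  IsUnit e = e ≡ + 1 ⊎ e ≡ - (+ 1)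

  IsUnit⇒e*e≡1 : ∀ {e} → IsUnit e → e * e ≡ + 1
  IsUnit⇒e*e≡1 (inj₁ refl) = refl
  IsUnit⇒e*e≡1 (inj₂ refl) = refl

  IsUnit⇒≢0 : ∀ {e} → IsUnit e → e ≢ + 0
  IsUnit⇒≢0 (inj₁ refl) ()
  IsUnit⇒≢0 (inj₂ refl) ()

  IsUnit-swap : ∀ {e x y} → IsUnit e → x ≡ e * y → y ≡ e * x
  IsUnit-swap {y = y} (inj₁ refl) x≡y =
    trans (sym (ℤP.*-identityˡ y)) (trans (sym x≡y) (sym (ℤP.*-identityˡ _)))
  IsUnit-swap {y = y} (inj₂ refl) refl = double-negation y
    where
    double-negation : ∀ y → y ≡ - + 1 * (- + 1 * y)
    double-negation = solve-∀

  IsUnit-*-trichotomy : ∀ {e x} → IsUnit e → x ≡ + 0 ⊎ IsUnit x → e * x ≡ + 0 ⊎ IsUnit (e * x)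
  IsUnit-*-trichotomy (inj₁ refl) (inj₁ refl)        = inj₁ refl
  IsUnit-*-trichotomy (inj₂ refl) (inj₁ refl)        = inj₁ refl
  IsUnit-*-trichotomy (inj₁ refl) (inj₂ (inj₁ refl)) = inj₂ (inj₁ refl)
  IsUnit-*-trichotomy (inj₁ refl) (inj₂ (inj₂ refl)) = inj₂ (inj₂ refl)
  IsUnit-*-trichotomy (inj₂ refl) (inj₂ (inj₁ refl)) = inj₂ (inj₂ refl)
  IsUnit-*-trichotomy (inj₂ refl) (inj₂ (inj₂ refl)) = inj₂ (inj₁ refl)

  schurComplement : ∀ {k} → Matrix (suc k) (suc k) → Matrix k k
  schurComplement M a b = M (suc a) (suc b) - M zero zero * M (suc a) zero * M zero (suc b)

  -- Column operations with multipliers -e M₀c clear the first row; the remaining minor is the Schur complement.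
  det-schur : ∀ {k} (M : Matrix (suc k) (suc k)) → IsUnit (M zero zero) →
    det M ≡ M zero zero * det (schurComplement M)
  det-schur {k} M unit = begin
    det M
      ≡⟨ sym (det-addColumn₀Multiples M h) ⟩
    det M̃
      ≡⟨ det-first-row-cleared M̃ row₀-cleared ⟩
    e * det (minor M̃ zero)
      ≡⟨ cong (e *_) (det-cong λ a b → minor≡schur (M (suc a) (suc b)) (M (suc a) zero) e (M zero (suc b))) ⟩
    e * det (schurComplement M)
      ∎
    where
    open ≡-Reasoning
    e = M zero zero
    h : Fin k → ℤ
    h c = - (e * M zero (suc c))
    M̃ = addColumn₀Multiples M h
    row₀-cleared : ∀ c → M̃ zero (suc c) ≡ + 0
    row₀-cleared c = trans (cleared (M zero (suc c)) e)
      (trans (cong (λ y → M zero (suc c) - y * M zero (suc c)) (IsUnit⇒e*e≡1 unit))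
             (cancel (M zero (suc c))))
      where
      cleared : ∀ x e → x + e * (- (e * x)) ≡ x - (e * e) * x
      cleared = solve-∀
      cancel : ∀ x → x - + 1 * x ≡ + 0
      cancel = solve-∀
    minor≡schur : ∀ x y e z → x + y * (- (e * z)) ≡ x - e * y * z
    minor≡schur = solve-∀

  -- Total unimodularity and pivoting

  TU-entry : ∀ {n m} (B : Matrix n m) → TotallyUnimodular B → ∀ p q → B p q ≡ + 0 ⊎ IsUnit (B p q)
  TU-entry B tu p q = subst (λ x → x ≡ + 0 ⊎ IsUnit x) (det₁ (B p q))
    (tu 1 (λ _ → p) (λ _ → q) injective₁ injective₁)
    where
    injective₁ : ∀ {A : Set} {f : Fin 1 → A} → Injective _≡_ _≡_ f
    injective₁ {x = zero} {y = zero} _ = refl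
    det₁ : ∀ x → + 1 * (x * + 1) + + 0 ≡ x
    det₁ = solve-∀

  TU-nonzero-entry : ∀ {n m} (B : Matrix n m) → TotallyUnimodular B →
    ∀ p q → B p q ≢ + 0 → IsUnit (B p q)
  TU-nonzero-entry B tu p q Bpq≢0 = [ ⊥-elim ∘ Bpq≢0 , id ]′ (TU-entry B tu p q)

  TU-selectColumns : ∀ {n m k} (B : Matrix n m) (s : Fin k → Fin m) → Injective _≡_ _≡_ s →
    TotallyUnimodular B → TotallyUnimodular (λ a b → B a (s b))
  TU-selectColumns B s s-inj tu k r c r-inj c-inj = tu k r (s ∘ c) r-inj (c-inj ∘ s-inj)

  pivot : ∀ {n m} → Matrix (suc n) (suc m) → Fin (suc n) → Fin (suc m) → Matrix n m
  pivot B p q a b = B (punchIn p a) (punchIn q b) - B p q * B (punchIn p a) q * B p (punchIn q b)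

  extendSelection : ∀ {n k} → Fin (suc n) → (Fin k → Fin n) → Fin (suc k) → Fin (suc n)
  extendSelection p r zero    = p
  extendSelection p r (suc a) = punchIn p (r a)

  extendSelection-injective : ∀ {n k} (p : Fin (suc n)) (r : Fin k → Fin n) →
    Injective _≡_ _≡_ r → Injective _≡_ _≡_ (extendSelection p r)
  extendSelection-injective p r r-inj {zero}  {zero}  e = refl
  extendSelection-injective p r r-inj {zero}  {suc y} e = ⊥-elim (FinP.punchInᵢ≢i p (r y) (sym e))
  extendSelection-injective p r r-inj {suc x} {zero}  e = ⊥-elim (FinP.punchInᵢ≢i p (r x) e)
  extendSelection-injective p r r-inj {suc x} {suc y} e =
    cong suc (r-inj (FinP.punchIn-injective p (r x) (r y) e))

  -- A square submatrix of the pivot is the Schur complement of a square submatrix of B one size larger.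
  pivot-TU : ∀ {n m} (B : Matrix (suc n) (suc m)) p q → IsUnit (B p q) →
    TotallyUnimodular B → TotallyUnimodular (pivot B p q)
  pivot-TU B p q unit tu k r c r-inj c-inj =
    subst (λ x → x ≡ + 0 ⊎ IsUnit x) (sym (IsUnit-swap unit (det-schur (submatrix B R C) unit)))
      (IsUnit-*-trichotomy unit (tu (suc k) R C (extendSelection-injective p r r-inj)
                                                (extendSelection-injective q c c-inj)))
    where
    R = extendSelection p r
    C = extendSelection q c

  InL-cong : ∀ {n m} (A : Matrix n m) (x : Vector m) {y : Vector m} →
    (∀ j → x j ≡ y j) → InL A x → InL A y
  InL-cong A x x≗y xL i = trans (sumℤ-cong (λ j → cong (A i j *_) (sym (x≗y j)))) (xL i)

  InL-lincomb : ∀ {n m} (A : Matrix n m) (x y : Vector m) → InL A x → InL A y →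
    ∀ a b → InL A (λ j → a * x j + b * y j)
  InL-lincomb A x y xL yL a b i = begin
    sumℤ (λ j → A i j * (a * x j + b * y j))
      ≡⟨ sumℤ-cong (λ j → distrib (A i j) a (x j) b (y j)) ⟩
    sumℤ (λ j → a * (A i j * x j) + b * (A i j * y j))
      ≡⟨ sumℤ-lincomb a b (λ j → A i j * x j) (λ j → A i j * y j) ⟩
    a * sumℤ (λ j → A i j * x j) + b * sumℤ (λ j → A i j * y j)
      ≡⟨ cong₂ (λ s t → a * s + b * t) (xL i) (yL i) ⟩
    a * + 0 + b * + 0
      ≡⟨ vanish a b ⟩
    + 0
      ∎
    where
    open ≡-Reasoning
    distrib : ∀ w a x b y → w * (a * x + b * y) ≡ a * (w * x) + b * (w * y)
    distrib = solve-∀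
    vanish : ∀ a b → a * + 0 + b * + 0 ≡ + 0
    vanish = solve-∀

  InL-neg : ∀ {n m} (A : Matrix n m) (y : Vector m) → InL A y → InL A (λ j → - y j)
  InL-neg A y yL i = trans (sumℤ-cong (λ j → sym (ℤP.neg-distribʳ-* (A i j) (y j))))
    (trans (sumℤ-neg (λ j → A i j * y j)) (cong (λ s → - s) (yL i)))

  InL-cancel : ∀ {n m} (A : Matrix n m) (x : Vector m) c → c ≢ + 0 →
    InL A (λ j → c * x j) → InL A x
  InL-cancel A x c c≢0 cxL i = [ ⊥-elim ∘ c≢0 , id ]′ (ℤP.i*j≡0⇒i≡0∨j≡0 c c*sum≡0)
    where
    left-commute : ∀ c a x → c * (a * x) ≡ a * (c * x)
    left-commute = solve-∀
    c*sum≡0 : c * sumℤ (λ j → A i j * x j) ≡ + 0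
    c*sum≡0 = trans (sym (sumℤ-*ˡ c (λ j → A i j * x j)))
                    (trans (sumℤ-cong (λ j → left-commute c (A i j) (x j))) (cxL i))

  InL-removeAt-zero : ∀ {n m} (A : Matrix n (suc m)) (x : Vector (suc m)) j₀ → x j₀ ≡ + 0 →
    InL A x → InL (λ a b → A a (punchIn j₀ b)) (removeAt x j₀)
  InL-removeAt-zero A x j₀ x₀≡0 xL a = begin
    S                    ≡⟨ sym (ℤP.+-identityˡ S) ⟩
    + 0 + S              ≡⟨ cong (_+ S) (sym (trans (cong (A a j₀ *_) x₀≡0) (ℤP.*-zeroʳ (A a j₀)))) ⟩
    A a j₀ * x j₀ + S    ≡⟨ sym (sumℤ-remove j₀ (λ j → A a j * x j)) ⟩
    sumℤ (λ j → A a j * x j) ≡⟨ xL a ⟩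
    + 0                  ∎
    where
    open ≡-Reasoning
    S = sumℤ (λ b → A a (punchIn j₀ b) * x (punchIn j₀ b))

  InL-insertAt-zero : ∀ {n m} (A : Matrix n (suc m)) (y : Vector m) j₀ →
    InL (λ a b → A a (punchIn j₀ b)) y → InL A (insertAt y j₀ (+ 0))
  InL-insertAt-zero A y j₀ yL a = trans (sumℤ-insertAt (A a) y j₀ (+ 0))
    (trans (cong (_+ sumℤ (λ b → A a (punchIn j₀ b) * y b)) (ℤP.*-zeroʳ (A a j₀)))
           (trans (ℤP.+-identityˡ _) (yL a)))

  InL-unit-of-zero-column : ∀ {n m} (B : Matrix n (suc m)) q → (∀ p → B p q ≡ + 0) →
    InL B (insertAt (λ _ → + 0) q (+ 1))
  InL-unit-of-zero-column B q column≡0 p = trans (sumℤ-insertAt (B p) (λ _ → + 0) q (+ 1))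
    (cong₂ _+_ (trans (ℤP.*-identityʳ (B p q)) (column≡0 p))
               (sumℤ-zero (λ b → ℤP.*-zeroʳ (B p (punchIn q b)))))

  sumℤ-pivot-row : ∀ {n m} (B : Matrix (suc n) (suc m)) p q a (y : Vector m) →
    sumℤ (λ b → pivot B p q a b * y b) ≡
    sumℤ (λ b → B (punchIn p a) (punchIn q b) * y b)
      - B p q * B (punchIn p a) q * sumℤ (λ b → B p (punchIn q b) * y b)
  sumℤ-pivot-row B p q a y = begin
    sumℤ (λ b → (u b - c * w b) * y b)
      ≡⟨ sumℤ-cong (λ b → expand (u b) c (w b) (y b)) ⟩
    sumℤ (λ b → + 1 * (u b * y b) + (- c) * (w b * y b))
      ≡⟨ sumℤ-lincomb (+ 1) (- c) (λ b → u b * y b) (λ b → w b * y b) ⟩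
    + 1 * sumℤ (λ b → u b * y b) + (- c) * sumℤ (λ b → w b * y b)
      ≡⟨ collect (sumℤ (λ b → u b * y b)) c (sumℤ (λ b → w b * y b)) ⟩
    sumℤ (λ b → u b * y b) - c * sumℤ (λ b → w b * y b)
      ∎
    where
    open ≡-Reasoning
    u = λ b → B (punchIn p a) (punchIn q b)
    w = λ b → B p (punchIn q b)
    c = B p q * B (punchIn p a) q
    expand : ∀ u c w y → (u - c * w) * y ≡ + 1 * (u * y) + (- c) * (w * y)
    expand = solve-∀
    collect : ∀ S c T → + 1 * S + (- c) * T ≡ S - c * T
    collect = solve-∀

  InL-pivot-removeAt : ∀ {n m} (B : Matrix (suc n) (suc m)) p q → IsUnit (B p q) →
    (x : Vector (suc m)) → InL B x → InL (pivot B p q) (removeAt x q)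
  InL-pivot-removeAt B p q unit x xL a = begin
    sumℤ (λ b → pivot B p q a b * x (punchIn q b))
      ≡⟨ sumℤ-pivot-row B p q a (removeAt x q) ⟩
    S₁ - e * β * S₂
      ≡⟨ eliminate e β (x q) S₁ S₂ ⟩
    (β * x q + S₁) - e * β * (e * x q + S₂) + (e * e - + 1) * β * x q
      ≡⟨ cong₂ (λ r₁ r₂ → r₁ - e * β * r₂ + (e * e - + 1) * β * x q) row-a row-p ⟩
    + 0 - e * β * + 0 + (e * e - + 1) * β * x q
      ≡⟨ cong (λ s → + 0 - e * β * + 0 + (s - + 1) * β * x q) (IsUnit⇒e*e≡1 unit) ⟩
    + 0 - e * β * + 0 + (+ 1 - + 1) * β * x q
      ≡⟨ vanish e β (x q) ⟩
    + 0
      ∎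
    where
    open ≡-Reasoning
    e = B p q
    β = B (punchIn p a) q
    S₁ = sumℤ (λ b → B (punchIn p a) (punchIn q b) * x (punchIn q b))
    S₂ = sumℤ (λ b → B p (punchIn q b) * x (punchIn q b))
    row-a : β * x q + S₁ ≡ + 0
    row-a = trans (sym (sumℤ-remove q (λ j → B (punchIn p a) j * x j))) (xL (punchIn p a))
    row-p : e * x q + S₂ ≡ + 0
    row-p = trans (sym (sumℤ-remove q (λ j → B p j * x j))) (xL p)
    eliminate : ∀ e β ξ S₁ S₂ →
      S₁ - e * β * S₂ ≡ (β * ξ + S₁) - e * β * (e * ξ + S₂) + (e * e - + 1) * β * ξ
    eliminate = solve-∀
    vanish : ∀ e β ξ → + 0 - e * β * + 0 + (+ 1 - + 1) * β * ξ ≡ + 0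
    vanish = solve-∀

  -- The entry at q is chosen so that row p vanishes; the other rows then reduce to those of the pivot.
  InL-pivot-insertAt : ∀ {n m} (B : Matrix (suc n) (suc m)) p q → IsUnit (B p q) →
    (y : Vector m) → InL (pivot B p q) y →
    InL B (insertAt y q (- (B p q * sumℤ (λ b → B p (punchIn q b) * y b))))
  InL-pivot-insertAt B p q unit y yL i with punchIn-cases p i
  ... | inj₁ refl = begin
    sumℤ (λ j → B p j * insertAt y q t j)     ≡⟨ sumℤ-insertAt (B p) y q t ⟩
    e * - (e * S₂) + S₂                       ≡⟨ collect e S₂ ⟩
    S₂ - e * e * S₂                           ≡⟨ cong (λ s → S₂ - s * S₂) (IsUnit⇒e*e≡1 unit) ⟩
    S₂ - + 1 * S₂                             ≡⟨ vanish S₂ ⟩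
    + 0                                       ∎
    where
    open ≡-Reasoning
    e = B p q
    S₂ = sumℤ (λ b → B p (punchIn q b) * y b)
    t = - (e * S₂)
    collect : ∀ e S → e * - (e * S) + S ≡ S - e * e * S
    collect = solve-∀
    vanish : ∀ S → S - + 1 * S ≡ + 0
    vanish = solve-∀
  ... | inj₂ (a , refl) = begin
    sumℤ (λ j → B (punchIn p a) j * insertAt y q t j)   ≡⟨ sumℤ-insertAt (B (punchIn p a)) y q t ⟩
    β * - (e * S₂) + S₁                                 ≡⟨ collect β e S₂ S₁ ⟩
    S₁ - e * β * S₂                                     ≡⟨ sym (sumℤ-pivot-row B p q a y) ⟩
    sumℤ (λ b → pivot B p q a b * y b)                  ≡⟨ yL a ⟩
    + 0                                                 ∎
    where
    open ≡-Reasoning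
    e = B p q
    β = B (punchIn p a) q
    S₁ = sumℤ (λ b → B (punchIn p a) (punchIn q b) * y b)
    S₂ = sumℤ (λ b → B p (punchIn q b) * y b)
    t = - (e * S₂)
    collect : ∀ β e S₂ S₁ → β * - (e * S₂) + S₁ ≡ S₁ - e * β * S₂
    collect = solve-∀

  -- Support-minimal kernel vectors of totally unimodular matrices

  SupportMinimal : ∀ {n m} → Matrix n m → Vector m → Set
  SupportMinimal A x = ¬ (∃ λ y → InL A y × NonZero y × SuppStrictSub y x)

  NonZero⇒∃≢0 : ∀ {m} (y : Vector m) → NonZero y → ∃ λ j → y j ≢ + 0
  NonZero⇒∃≢0 {m} y = FinP.¬∀⟶∃¬ m (λ j → y j ≡ + 0) (λ j → y j ℤP.≟ + 0)

  ⊆⇒zeros : ∀ {m} {y x : Vector m} → (∀ j → y j ≢ + 0 → x j ≢ + 0) → ∀ j → x j ≡ + 0 → y j ≡ + 0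
  ⊆⇒zeros {y = y} y⊆x j xj≡0 = decidable-stable (y j ℤP.≟ + 0) (λ yj≢0 → y⊆x j yj≢0 xj≡0)

  zero-column-or-nonzero-entry : ∀ {n m} (B : Matrix n m) q → (∀ p → B p q ≡ + 0) ⊎ ∃ λ p → B p q ≢ + 0
  zero-column-or-nonzero-entry {n} B q with FinP.all? (λ p → B p q ℤP.≟ + 0)
  ... | yes column≡0 = inj₁ column≡0
  ... | no  column≢0 = inj₂ (FinP.¬∀⟶∃¬ n (λ p → B p q ≡ + 0) (λ p → B p q ℤP.≟ + 0) column≢0)

  insertAt-NonZero : ∀ {m} (y : Vector m) q t → NonZero y → NonZero (insertAt y q t)
  insertAt-NonZero y q t y≢0 all≡0 =
    y≢0 (λ b → trans (sym (insertAt-punchIn y q t b)) (all≡0 (punchIn q b)))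

  insertAt-SuppStrictSub : ∀ {m} (x : Vector (suc m)) (y : Vector m) q t → t ≡ + 0 ⊎ x q ≢ + 0 →
    SuppStrictSub y (removeAt x q) → SuppStrictSub (insertAt y q t) x
  insertAt-SuppStrictSub x y q t t-ok (sub , b , xb≢0 , yb≡0) =
    sub′ , punchIn q b , xb≢0 , trans (insertAt-punchIn y q t b) yb≡0
    where
    at-q : t ≡ + 0 ⊎ x q ≢ + 0 → insertAt y q t q ≢ + 0 → x q ≢ + 0
    at-q (inj₁ t≡0)  t≢0 = ⊥-elim (t≢0 (trans (insertAt-lookup y q t) t≡0))
    at-q (inj₂ xq≢0) _   = xq≢0
    sub′ : ∀ j → insertAt y q t j ≢ + 0 → x j ≢ + 0
    sub′ j with punchIn-cases q j
    ... | inj₁ refl        = at-q t-ok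
    ... | inj₂ (b′ , refl) = λ yb′≢0 → sub b′ (yb′≢0 ∘ trans (insertAt-punchIn y q t b′))

  SupportMinimal-reduce : ∀ {n n′ m} (B : Matrix n (suc m)) (B′ : Matrix n′ m) (x : Vector (suc m)) q →
    (∀ y → InL B′ y → ∃ λ t → InL B (insertAt y q t) × (t ≡ + 0 ⊎ x q ≢ + 0)) →
    SupportMinimal B x → SupportMinimal B′ (removeAt x q)
  SupportMinimal-reduce B B′ x q lift minimal (y , yL , y≢0 , y⊂x) with lift y yL
  ... | t , yL′ , t-ok =
    minimal (insertAt y q t , yL′ , insertAt-NonZero y q t y≢0 , insertAt-SuppStrictSub x y q t t-ok y⊂x)

  SupportMinimal-zero-column : ∀ {n m} (B : Matrix n (suc m)) (x : Vector (suc m)) q →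
    SupportMinimal B x → (∀ p → B p q ≡ + 0) → x q ≢ + 0 → ∀ i → i ≢ q → x i ≡ + 0
  SupportMinimal-zero-column B x q minimal column≡0 xq≢0 i i≢q =
    decidable-stable (x i ℤP.≟ + 0) λ xi≢0 →
      minimal (eq , InL-unit-of-zero-column B q column≡0 , eq≢0 , sub , i , xi≢0 , eq-i)
    where
    eq : Vector (suc _)
    eq = insertAt (λ _ → + 0) q (+ 1)
    eq≢0 : NonZero eq
    eq≢0 all≡0 with trans (sym (insertAt-lookup (λ _ → + 0) q (+ 1))) (all≡0 q)
    ... | ()
    sub : ∀ j → eq j ≢ + 0 → x j ≢ + 0
    sub j with punchIn-cases q j
    ... | inj₁ refl       = λ _ → xq≢0
    ... | inj₂ (b , refl) = λ eqj≢0 → ⊥-elim (eqj≢0 (insertAt-punchIn (λ _ → + 0) q (+ 1) b))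
    eq-i : eq i ≡ + 0
    eq-i with punchIn-cases q i
    ... | inj₁ i≡q        = ⊥-elim (i≢q i≡q)
    ... | inj₂ (b , refl) = insertAt-punchIn (λ _ → + 0) q (+ 1) b

  ∣unit*x∣≡∣x∣ : ∀ {a} x → IsUnit a → ∣ a * x ∣ ≡ ∣ x ∣
  ∣unit*x∣≡∣x∣ x (inj₁ refl) = cong ∣_∣ (ℤP.*-identityˡ x)
  ∣unit*x∣≡∣x∣ x (inj₂ refl) = trans (ℤP.abs-* (- (+ 1)) x) (ℕP.+-identityʳ ∣ x ∣)

  ∣s∣≡∣t∣-from-row : ∀ a b s t → IsUnit a → b ≡ + 0 ⊎ IsUnit b → s ≢ + 0 →
    a * s + b * t ≡ + 0 → ∣ s ∣ ≡ ∣ t ∣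
  ∣s∣≡∣t∣-from-row a b s t a-unit (inj₁ refl) s≢0 row =
    ⊥-elim ([ IsUnit⇒≢0 a-unit , s≢0 ]′ (ℤP.i*j≡0⇒i≡0∨j≡0 a (trans (sym (ℤP.+-identityʳ (a * s))) row)))
  ∣s∣≡∣t∣-from-row a b s t a-unit (inj₂ b-unit) s≢0 row = begin
    ∣ s ∣                    ≡⟨ sym (∣unit*x∣≡∣x∣ s a-unit) ⟩
    ∣ a * s ∣                ≡⟨ cong ∣_∣ (isolate (a * s) (b * t)) ⟩
    ∣ (a * s + b * t) - b * t ∣ ≡⟨ cong (λ r → ∣ r - b * t ∣) row ⟩
    ∣ + 0 - b * t ∣          ≡⟨ cong ∣_∣ (ℤP.+-identityˡ (- (b * t))) ⟩
    ∣ - (b * t) ∣            ≡⟨ ℤP.∣-i∣≡∣i∣ (b * t) ⟩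
    ∣ b * t ∣                ≡⟨ ∣unit*x∣≡∣x∣ t b-unit ⟩
    ∣ t ∣                    ∎
    where
    open ≡-Reasoning
    isolate : ∀ u v → u ≡ (u + v) - v
    isolate = solve-∀

  ConstantAbsOnSupport : ∀ {m} → Vector m → Set
  ConstantAbsOnSupport x = ∀ i j → x i ≢ + 0 → x j ≢ + 0 → ∣ x i ∣ ≡ ∣ x j ∣

  ConstantAbsOnSupport-removeAt : ∀ {m} (x : Vector (suc m)) q → ConstantAbsOnSupport (removeAt x q) →
    ∀ i j → q ≢ i → q ≢ j → x i ≢ + 0 → x j ≢ + 0 → ∣ x i ∣ ≡ ∣ x j ∣
  ConstantAbsOnSupport-removeAt x q constant i j q≢i q≢j xi≢0 xj≢0 =
    subst₂ (λ i′ j′ → ∣ x i′ ∣ ≡ ∣ x j′ ∣) (FinP.punchIn-punchOut q≢i) (FinP.punchIn-punchOut q≢j)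
      (constant (punchOut q≢i) (punchOut q≢j)
        (subst (λ i′ → x i′ ≢ + 0) (sym (FinP.punchIn-punchOut q≢i)) xi≢0)
        (subst (λ j′ → x j′ ≢ + 0) (sym (FinP.punchIn-punchOut q≢j)) xj≢0))

  TUKernelConstantAbs : ℕ → Set
  TUKernelConstantAbs m = ∀ {n} (B : Matrix n m) → TotallyUnimodular B →
    (x : Vector m) → InL B x → SupportMinimal B x → ConstantAbsOnSupport x

  constantAbs-delete-zero-entry : ∀ {m} → TUKernelConstantAbs m →
    ∀ {n} (B : Matrix n (suc m)) → TotallyUnimodular B → (x : Vector (suc m)) → InL B x →
    SupportMinimal B x → ∀ j₀ → x j₀ ≡ + 0 → ConstantAbsOnSupport x
  constantAbs-delete-zero-entry IH B tu x xL minimal j₀ x₀≡0 i j xi≢0 xj≢0 =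
    ConstantAbsOnSupport-removeAt x j₀
      (IH B′ (TU-selectColumns B (punchIn j₀) (FinP.punchIn-injective j₀ _ _) tu) (removeAt x j₀)
          (InL-removeAt-zero B x j₀ x₀≡0 xL)
          (SupportMinimal-reduce B B′ x j₀
            (λ y yL → + 0 , InL-insertAt-zero B y j₀ yL , inj₁ refl) minimal))
      i j (avoids xi≢0) (avoids xj≢0) xi≢0 xj≢0
    where
    B′ = λ a b → B a (punchIn j₀ b)
    avoids : ∀ {k} → x k ≢ + 0 → j₀ ≢ k
    avoids xk≢0 refl = xk≢0 x₀≡0

  constantAbs-pivot : ∀ {m} → TUKernelConstantAbs m →
    ∀ {n} (B : Matrix n (suc m)) → TotallyUnimodular B → (x : Vector (suc m)) → InL B x →
    SupportMinimal B x → ∀ p q → B p q ≢ + 0 → x q ≢ + 0 →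
    ∀ i j → q ≢ i → q ≢ j → x i ≢ + 0 → x j ≢ + 0 → ∣ x i ∣ ≡ ∣ x j ∣
  constantAbs-pivot IH {suc n} B tu x xL minimal p q Bpq≢0 xq≢0 =
    ConstantAbsOnSupport-removeAt x q
      (IH (pivot B p q) (pivot-TU B p q unit tu) (removeAt x q) (InL-pivot-removeAt B p q unit x xL)
          (SupportMinimal-reduce B (pivot B p q) x q
            (λ y yL → _ , InL-pivot-insertAt B p q unit y yL , inj₂ xq≢0) minimal))
    where
    unit = TU-nonzero-entry B tu p q Bpq≢0

  -- A zero column q would make the unit vector at q a kernel vector of smaller support.
  constantAbs-full-support : ∀ {m} → TUKernelConstantAbs m →
    ∀ {n} (B : Matrix n (suc m)) → TotallyUnimodular B → (x : Vector (suc m)) → InL B x →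
    SupportMinimal B x → (∀ k → x k ≢ + 0) → ∀ q i j → q ≢ i → q ≢ j → ∣ x i ∣ ≡ ∣ x j ∣
  constantAbs-full-support IH B tu x xL minimal full q i j q≢i q≢j with zero-column-or-nonzero-entry B q
  ... | inj₁ column≡0 =
    ⊥-elim (full i (SupportMinimal-zero-column B x q minimal column≡0 (full q) i (q≢i ∘ sym)))
  ... | inj₂ (p , Bpq≢0) =
    constantAbs-pivot IH B tu x xL minimal p q Bpq≢0 (full q) i j q≢i q≢j (full i) (full j)

  constantAbs-two-columns : ∀ {n m} (B : Matrix n m) → TotallyUnimodular B → (x : Vector m) → InL B x →
    SupportMinimal B x → ∀ i j → i ≢ j → (∀ q → q ≡ i ⊎ q ≡ j) →
    x i ≢ + 0 → x j ≢ + 0 → ∣ x i ∣ ≡ ∣ x j ∣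
  constantAbs-two-columns {m = suc m} B tu x xL minimal i j i≢j only-i-j xi≢0 xj≢0
    with zero-column-or-nonzero-entry B i
  ... | inj₁ column≡0 =
    ⊥-elim (xj≢0 (SupportMinimal-zero-column B x i minimal column≡0 xi≢0 j (i≢j ∘ sym)))
  ... | inj₂ (p , Bpi≢0) = ∣s∣≡∣t∣-from-row (B p i) (B p j) (x i) (x j)
    (TU-nonzero-entry B tu p i Bpi≢0) (TU-entry B tu p j) xi≢0
    (trans (sym (sumℤ-pair i j i≢j only-i-j (λ c → B p c * x c))) (xL p))

  -- Induction on the number of columns: delete a column where x vanishes, or pivot on a third column.
  supportMinimal-constantAbs : ∀ m → TUKernelConstantAbs m
  supportMinimal-constantAbs (suc m) B tu x xL minimal i j xi≢0 xj≢0 with i FinP.≟ j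
  ... | yes refl = refl
  ... | no i≢j with FinP.any? (λ j₀ → x j₀ ℤP.≟ + 0)
  ...   | yes (j₀ , x₀≡0) =
    constantAbs-delete-zero-entry (supportMinimal-constantAbs m) B tu x xL minimal j₀ x₀≡0 i j xi≢0 xj≢0
  ...   | no ∄zero with FinP.any? (λ q → ¬? (q FinP.≟ i) ×-dec ¬? (q FinP.≟ j))
  ...     | yes (q , q≢i , q≢j) = constantAbs-full-support (supportMinimal-constantAbs m) B tu x xL minimal
                                    (λ k xk≡0 → ∄zero (k , xk≡0)) q i j q≢i q≢j
  ...     | no ∄third = constantAbs-two-columns B tu x xL minimal i j i≢j
                          (no-third⇒only-two i j ∄third) xi≢0 xj≢0

  -- Conformal reduction

  data SameSign : ℤ → ℤ → Set where
    both+ : ∀ m n → SameSign +[1+ m ] +[1+ n ]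
    both- : ∀ m n → SameSign -[1+ m ] -[1+ n ]

  SameSign? : ∀ a b → Dec (SameSign a b)
  SameSign? +[1+ m ] +[1+ n ] = yes (both+ m n)
  SameSign? -[1+ m ] -[1+ n ] = yes (both- m n)
  SameSign? (+ zero) _        = no λ ()
  SameSign? +[1+ m ] (+ zero) = no λ ()
  SameSign? +[1+ m ] -[1+ n ] = no λ ()
  SameSign? -[1+ m ] (+ _)    = no λ ()

  SameSign-refl : ∀ a → a ≢ + 0 → SameSign a a
  SameSign-refl (+ zero)  a≢0 = ⊥-elim (a≢0 refl)
  SameSign-refl +[1+ n ] _   = both+ n n
  SameSign-refl -[1+ n ] _   = both- n n

  SameSign-trans : ∀ {a b c} → SameSign a b → SameSign b c → SameSign a c
  SameSign-trans (both+ m _) (both+ _ n) = both+ m n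
  SameSign-trans (both- m _) (both- _ n) = both- m n

  SameSign-≢0ʳ : ∀ {a b} → SameSign a b → b ≢ + 0
  SameSign-≢0ʳ (both+ m n) ()
  SameSign-≢0ʳ (both- m n) ()

  SameSign-neg : ∀ {a b} → SameSign a b → SameSign (- a) (- b)
  SameSign-neg (both+ m n) = both- m n
  SameSign-neg (both- m n) = both+ m n

  SameSign-or-opposite : ∀ a b → a ≢ + 0 → b ≢ + 0 → SameSign a b ⊎ SameSign (- a) b
  SameSign-or-opposite (+ zero) b a≢0 _   = ⊥-elim (a≢0 refl)
  SameSign-or-opposite a (+ zero) _   b≢0 = ⊥-elim (b≢0 refl)
  SameSign-or-opposite +[1+ m ] +[1+ n ] _ _ = inj₁ (both+ m n)
  SameSign-or-opposite +[1+ m ] -[1+ n ] _ _ = inj₂ (both- m n)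
  SameSign-or-opposite -[1+ m ] +[1+ n ] _ _ = inj₂ (both+ m n)
  SameSign-or-opposite -[1+ m ] -[1+ n ] _ _ = inj₁ (both- m n)

  SameSign⇒∣∣≡suc : ∀ {a b} → SameSign a b → ∃ λ k → ∣ a ∣ ≡ suc k
  SameSign⇒∣∣≡suc (both+ m n) = m , refl
  SameSign⇒∣∣≡suc (both- m n) = m , refl

  SameSign-cross : ∀ {u v} → SameSign u v → + ∣ u ∣ * v - + ∣ v ∣ * u ≡ + 0
  SameSign-cross (both+ m n) = cancel (+ suc m) (+ suc n)
    where
    cancel : ∀ A B → A * B - B * A ≡ + 0
    cancel = solve-∀
  SameSign-cross (both- m n) = cancel (+ suc m) (+ suc n)
    where
    cancel : ∀ A B → A * (- B) - B * (- A) ≡ + 0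
    cancel = solve-∀

  Conformal : ∀ {m} → Vector m → Vector m → Set
  Conformal u x = ∀ j → u j ≡ + 0 ⊎ SameSign (u j) (x j)

  Conformal-refl : ∀ {m} (x : Vector m) → Conformal x x
  Conformal-refl x j with x j ℤP.≟ + 0
  ... | yes xj≡0 = inj₁ xj≡0
  ... | no  xj≢0 = inj₂ (SameSign-refl (x j) xj≢0)

  Conformal-trans : ∀ {m} {u z x : Vector m} → Conformal u z → Conformal z x → Conformal u x
  Conformal-trans u⊑z z⊑x j with u⊑z j | z⊑x j
  ... | inj₁ uj≡0 | _         = inj₁ uj≡0
  ... | inj₂ s    | inj₁ zj≡0 = ⊥-elim (SameSign-≢0ʳ s zj≡0)
  ... | inj₂ s    | inj₂ s′   = inj₂ (SameSign-trans s s′)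

  Conformal⇒⊆ : ∀ {m} {u x : Vector m} → Conformal u x → ∀ j → u j ≢ + 0 → x j ≢ + 0
  Conformal⇒⊆ u⊑x j uj≢0 with u⊑x j
  ... | inj₁ uj≡0 = ⊥-elim (uj≢0 uj≡0)
  ... | inj₂ s    = SameSign-≢0ʳ s

  nonZeroIndicator : ℤ → ℕ
  nonZeroIndicator (+ zero) = 0
  nonZeroIndicator +[1+ n ] = 1
  nonZeroIndicator -[1+ n ] = 1

  suppSize : ∀ {m} → Vector m → ℕ
  suppSize x = sumℕ (λ j → nonZeroIndicator (x j))

  suppSize≡0⇒≡0 : ∀ {m} (x : Vector m) → suppSize x ≡ 0 → ∀ j → x j ≡ + 0
  suppSize≡0⇒≡0 x size≡0 j = indicator≡0 (x j) (sumℕ≡0⇒≡0 _ size≡0 j)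
    where
    indicator≡0 : ∀ a → nonZeroIndicator a ≡ 0 → a ≡ + 0
    indicator≡0 (+ zero) _ = refl

  suppSize-< : ∀ {m} (z x : Vector (suc m)) → (∀ j → z j ≢ + 0 → x j ≢ + 0) →
    ∀ j₀ → z j₀ ≡ + 0 → x j₀ ≢ + 0 → suppSize z ℕ.< suppSize x
  suppSize-< z x z⊆x j₀ zj₀≡0 xj₀≢0 = begin-strict
    suppSize z
      ≡⟨ sumℕ-remove j₀ (nonZeroIndicator ∘ z) ⟩
    nonZeroIndicator (z j₀) ℕ.+ sumℕ (nonZeroIndicator ∘ z ∘ punchIn j₀)
      ≡⟨ cong (λ a → nonZeroIndicator a ℕ.+ sumℕ (nonZeroIndicator ∘ z ∘ punchIn j₀)) zj₀≡0 ⟩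
    sumℕ (nonZeroIndicator ∘ z ∘ punchIn j₀)
      <⟨ s≤s (sumℕ-mono-≤ λ b → indicator-mono (z (punchIn j₀ b)) (x (punchIn j₀ b)) (z⊆x (punchIn j₀ b))) ⟩
    1 ℕ.+ sumℕ (nonZeroIndicator ∘ x ∘ punchIn j₀)
      ≡⟨ cong (ℕ._+ sumℕ (nonZeroIndicator ∘ x ∘ punchIn j₀)) (sym (indicator≡1 (x j₀) xj₀≢0)) ⟩
    nonZeroIndicator (x j₀) ℕ.+ sumℕ (nonZeroIndicator ∘ x ∘ punchIn j₀)
      ≡⟨ sym (sumℕ-remove j₀ (nonZeroIndicator ∘ x)) ⟩
    suppSize x
      ∎
    where
    open ℕP.≤-Reasoning
    indicator≡1 : ∀ a → a ≢ + 0 → nonZeroIndicator a ≡ 1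
    indicator≡1 (+ zero) a≢0 = ⊥-elim (a≢0 refl)
    indicator≡1 +[1+ n ] _ = refl
    indicator≡1 -[1+ n ] _ = refl
    indicator-mono : ∀ a b → (a ≢ + 0 → b ≢ + 0) → nonZeroIndicator a ℕ.≤ nonZeroIndicator b
    indicator-mono (+ zero) b _   = z≤n
    indicator-mono +[1+ n ] b a⊆b = ℕP.≤-reflexive (sym (indicator≡1 b (a⊆b λ ())))
    indicator-mono -[1+ n ] b a⊆b = ℕP.≤-reflexive (sym (indicator≡1 b (a⊆b λ ())))

  ≡0-or-positive : ∀ d n → + d ≡ + 0 ⊎ SameSign (+ d) +[1+ n ]
  ≡0-or-positive zero    n = inj₁ refl
  ≡0-or-positive (suc d) n = inj₂ (both+ d n)

  conformal-difference-positive : ∀ a b n t → (SameSign t +[1+ n ] → b ℕ.* ∣ t ∣ ℕ.≤ suc a ℕ.* suc n) →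
    + suc a * +[1+ n ] - + b * t ≡ + 0 ⊎ SameSign (+ suc a * +[1+ n ] - + b * t) +[1+ n ]
  conformal-difference-positive a b n (+ zero) _ =
    inj₂ (subst (λ z → SameSign z +[1+ n ]) (sym (drop (+ suc a * +[1+ n ]) (+ b))) (both+ _ n))
    where
    drop : ∀ S B → S - B * + 0 ≡ S
    drop = solve-∀
  conformal-difference-positive a b n +[1+ k ] bound =
    subst (λ z → z ≡ + 0 ⊎ SameSign z +[1+ n ]) (sym z≡M∸N) (≡0-or-positive (M ℕ.∸ N) n)
    where
    M = suc a ℕ.* suc n
    N = b ℕ.* suc k
    z≡M∸N : + suc a * +[1+ n ] - + b * +[1+ k ] ≡ + (M ℕ.∸ N)
    z≡M∸N = trans (cong (λ w → + M - w) (sym (ℤP.pos-* b (suc k))))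
                  (trans (ℤP.m-n≡m⊖n M N) (ℤP.⊖-≥ (bound (both+ k n))))
  conformal-difference-positive a b n -[1+ k ] _ =
    inj₂ (subst (λ z → SameSign z +[1+ n ]) (sym z≡M+N) (both+ _ n))
    where
    M = suc a ℕ.* suc n
    N = b ℕ.* suc k
    add : ∀ S B K → S - B * (- K) ≡ S + B * K
    add = solve-∀
    z≡M+N : + suc a * +[1+ n ] - + b * -[1+ k ] ≡ + (M ℕ.+ N)
    z≡M+N = trans (add (+ M) (+ b) (+ suc k))
                  (trans (cong (_+_ (+ M)) (sym (ℤP.pos-* b (suc k)))) (sym (ℤP.pos-+ M N)))

  conformal-difference : ∀ a b s t → (s ≡ + 0 → t ≡ + 0) →
    (SameSign t s → b ℕ.* ∣ t ∣ ℕ.≤ suc a ℕ.* ∣ s ∣) →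
    + suc a * s - + b * t ≡ + 0 ⊎ SameSign (+ suc a * s - + b * t) s
  conformal-difference a b (+ zero) t t≡0 _ rewrite t≡0 refl = inj₁ (vanish (+ suc a) (+ b))
    where
    vanish : ∀ a b → a * + 0 - b * + 0 ≡ + 0
    vanish = solve-∀
  conformal-difference a b +[1+ n ] t _ bound = conformal-difference-positive a b n t bound
  conformal-difference a b -[1+ n ] t _ bound =
    subst (λ z → z ≡ + 0 ⊎ SameSign z -[1+ n ]) (sym (negate (+ suc a) -[1+ n ] (+ b) t))
      (Sum.map (cong (λ z → - z)) SameSign-neg (conformal-difference-positive a b n (- t) bound′))
    where
    negate : ∀ A S B T → A * S - B * T ≡ - (A * (- S) - B * (- T))
    negate = solve-∀
    bound′ : SameSign (- t) +[1+ n ] → b ℕ.* ∣ - t ∣ ℕ.≤ suc a ℕ.* suc n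
    bound′ s = subst (λ w → b ℕ.* w ℕ.≤ suc a ℕ.* suc n) (sym (ℤP.∣-i∣≡∣i∣ t))
                     (bound (subst (λ u → SameSign u -[1+ n ]) (ℤP.neg-involutive t) (SameSign-neg s)))

  -- Subtract the largest multiple of y (with y aligned to x at j₁) that keeps the result conformal to x.
  conformal-reduction-aligned : ∀ {n m} (A : Matrix n m) (x y : Vector m) → InL A x → InL A y →
    ∀ j₁ → SameSign (y j₁) (x j₁) → (∀ j → x j ≡ + 0 → y j ≡ + 0) → ∀ j₂ → x j₂ ≢ + 0 → y j₂ ≡ + 0 →
    ∃ λ z → InL A z × NonZero z × Conformal z x × suppSize z ℕ.< suppSize x
  conformal-reduction-aligned {m = suc m} A x y xL yL j₁ s₁ x≡0⇒y≡0 j₂ xj₂≢0 yj₂≡0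
    with minimal-element (λ j → SameSign? (y j) (x j))
                         (λ j k → ∣ x j ∣ ℕ.* ∣ y k ∣ ℕ.≤ ∣ x k ∣ ℕ.* ∣ y j ∣)
           (λ j k → ℕP.≤-total _ _) ratio-trans (j₁ , s₁)
    where
    ratio-trans : ∀ {i j k} → SameSign (y i) (x i) → SameSign (y j) (x j) → SameSign (y k) (x k) →
      ∣ x i ∣ ℕ.* ∣ y j ∣ ℕ.≤ ∣ x j ∣ ℕ.* ∣ y i ∣ → ∣ x j ∣ ℕ.* ∣ y k ∣ ℕ.≤ ∣ x k ∣ ℕ.* ∣ y j ∣ →
      ∣ x i ∣ ℕ.* ∣ y k ∣ ℕ.≤ ∣ x k ∣ ℕ.* ∣ y i ∣
    ratio-trans {i} {j} {k} _ sj _ h₁ h₂ with SameSign⇒∣∣≡suc sj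
    ... | w , ∣yj∣≡1+w rewrite ∣yj∣≡1+w =
      cross-≤-trans (∣ x i ∣) (∣ x j ∣) (∣ x k ∣) (∣ y i ∣) (∣ y k ∣) w h₁ h₂
  ... | j₀ , s₀ , j₀-max-ratio with SameSign⇒∣∣≡suc s₀
  ... | a , ∣yj₀∣≡1+a =
    z , zL , z≢0 , z⊑x , suppSize-< z x (Conformal⇒⊆ z⊑x) j₀ zj₀≡0 (SameSign-≢0ʳ s₀)
    where
    b = ∣ x j₀ ∣
    z : Vector (suc m)
    z j = + suc a * x j - + b * y j
    zL : InL A z
    zL = InL-cong A (λ j → + suc a * x j + - + b * y j)
           (λ j → cong (_+_ (+ suc a * x j)) (sym (ℤP.neg-distribˡ-* (+ b) (y j))))
           (InL-lincomb A x y xL yL (+ suc a) (- + b))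
    z⊑x : Conformal z x
    z⊑x j = conformal-difference a b (x j) (y j) (x≡0⇒y≡0 j)
      (λ s → subst (b ℕ.* ∣ y j ∣ ℕ.≤_)
                   (trans (cong (∣ x j ∣ ℕ.*_) ∣yj₀∣≡1+a) (ℕP.*-comm ∣ x j ∣ (suc a)))
                   (j₀-max-ratio j s))
    zj₀≡0 : z j₀ ≡ + 0
    zj₀≡0 = subst (λ w → + w * x j₀ - + b * y j₀ ≡ + 0) ∣yj₀∣≡1+a (SameSign-cross s₀)
    z≢0 : NonZero z
    z≢0 all≡0 = [ (λ ()) , xj₂≢0 ]′ (ℤP.i*j≡0⇒i≡0∨j≡0 (+ suc a) (trans (sym zj₂) (all≡0 j₂)))
      where
      zj₂ : z j₂ ≡ + suc a * x j₂
      zj₂ = trans (cong (λ t → + suc a * x j₂ - + b * t) yj₂≡0) (drop (+ suc a * x j₂) (+ b))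
        where
        drop : ∀ S B → S - B * + 0 ≡ S
        drop = solve-∀

  conformal-reduction : ∀ {n m} (A : Matrix n m) (x y : Vector m) → InL A x → InL A y → NonZero y →
    SuppStrictSub y x → ∃ λ z → InL A z × NonZero z × Conformal z x × suppSize z ℕ.< suppSize x
  conformal-reduction A x y xL yL y≢0 (y⊆x , j₂ , xj₂≢0 , yj₂≡0) with NonZero⇒∃≢0 y y≢0
  ... | j₁ , yj₁≢0 with SameSign-or-opposite (y j₁) (x j₁) yj₁≢0 (y⊆x j₁ yj₁≢0)
  ...   | inj₁ s₁ = conformal-reduction-aligned A x y xL yL j₁ s₁ (⊆⇒zeros y⊆x) j₂ xj₂≢0 yj₂≡0
  ...   | inj₂ s₁ = conformal-reduction-aligned A x (λ j → - y j) xL (InL-neg A y yL) j₁ s₁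
                      (λ j xj≡0 → cong (λ t → - t) (⊆⇒zeros y⊆x j xj≡0))
                      j₂ xj₂≢0 (cong (λ t → - t) yj₂≡0)

  conformal-supportMinimal : ∀ {n m} (A : Matrix n m) (x : Vector m) → InL A x → NonZero x →
    ¬ ¬ (∃ λ u → InL A u × NonZero u × SupportMinimal A u × Conformal u x)
  conformal-supportMinimal A x xL x≢0 = descend (suppSize x) x ℕP.≤-refl xL x≢0 (Conformal-refl x)
    where
    descend : ∀ bound z → suppSize z ℕ.≤ bound → InL A z → NonZero z → Conformal z x →
      ¬ ¬ (∃ λ u → InL A u × NonZero u × SupportMinimal A u × Conformal u x)
    descend zero        z size≤0 _  z≢0 _   _  = z≢0 (suppSize≡0⇒≡0 z (ℕP.n≤0⇒n≡0 size≤0))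
    descend (suc bound) z size≤  zL z≢0 z⊑x ¬∃ = ¬∃ (z , zL , z≢0 , minimal , z⊑x)
      where
      minimal : SupportMinimal A z
      minimal (y , yL , y≢0 , y⊂z) with conformal-reduction A z y zL yL y≢0 y⊂z
      ... | z′ , z′L , z′≢0 , z′⊑z , z′<z =
        descend bound z′ (ℕP.≤-pred (ℕP.≤-trans z′<z size≤)) z′L z′≢0 (Conformal-trans z′⊑z z⊑x) ¬∃

  -- Kernel vectors of norm below 2λ

  signum : ℤ → ℤ
  signum (+ zero) = + 0
  signum +[1+ n ] = + 1
  signum -[1+ n ] = - (+ 1)

  signum≡0⇒≡0 : ∀ a → signum a ≡ + 0 → a ≡ + 0
  signum≡0⇒≡0 (+ zero) _ = refl

  signum-scale : ∀ a c → (a ≢ + 0 → ∣ a ∣ ≡ c) → a ≡ + c * signum a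
  signum-scale (+ zero) c _ = sym (ℤP.*-zeroʳ (+ c))
  signum-scale +[1+ n ] c ∣a∣≡c rewrite sym (∣a∣≡c (λ ())) = sym (ℤP.*-identityʳ _)
  signum-scale -[1+ n ] c ∣a∣≡c rewrite sym (∣a∣≡c (λ ())) =
    sym (trans (ℤP.*-comm (+ suc n) (- + 1)) (ℤP.-1*i≡-i (+ suc n)))

  ∣signum∣+∣b-signum∣ : ∀ a b → a ≡ + 0 ⊎ SameSign a b → ∣ signum a ∣ ℕ.+ ∣ b - signum a ∣ ≡ ∣ b ∣
  ∣signum∣+∣b-signum∣ _ b (inj₁ refl) = cong ∣_∣ (ℤP.+-identityʳ b)
  ∣signum∣+∣b-signum∣ _ _ (inj₂ (both+ m n)) = refl
  ∣signum∣+∣b-signum∣ _ _ (inj₂ (both- m n)) = cong suc (trans (ℤP.∣m⊖n∣≡∣n⊖m∣ 1 (suc n))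
    (cong ∣_∣ (trans (ℤP.[1+m]⊖[1+n]≡m⊖n n 0) (ℤP.⊖-≥ z≤n))))

  SupportMinimal-signum : ∀ {n m} (A : Matrix n m) (u : Vector m) →
    SupportMinimal A u → SupportMinimal A (signum ∘ u)
  SupportMinimal-signum A u minimal (y , yL , y≢0 , y⊆ , j , uj≢0 , yj≡0) =
    minimal (y , yL , y≢0 , (λ i yi≢0 ui≡0 → y⊆ i yi≢0 (cong signum ui≡0)) ,
             j , uj≢0 ∘ cong signum , yj≡0)

  -- By the constant-modulus property, a support-minimal kernel vector is |u s| times its sign vector.
  signum-kernel : ∀ {n m} (A : Matrix n m) → TotallyUnimodular A → (u : Vector m) → InL A u → NonZero u →
    SupportMinimal A u → InL A (signum ∘ u)
  signum-kernel {m = m} A tu u uL u≢0 minimal with NonZero⇒∃≢0 u u≢0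
  ... | s , us≢0 = InL-cancel A (signum ∘ u) (+ ∣ u s ∣) (us≢0 ∘ ℤP.∣i∣≡0⇒i≡0 ∘ ℤP.+-injective)
    (InL-cong A u (λ j → signum-scale (u j) ∣ u s ∣ (∣uj∣≡∣us∣ j)) uL)
    where
    ∣uj∣≡∣us∣ : ∀ j → u j ≢ + 0 → ∣ u j ∣ ≡ ∣ u s ∣
    ∣uj∣≡∣us∣ j uj≢0 = supportMinimal-constantAbs m A tu u uL minimal j s uj≢0 us≢0

  2*λ≤ : ∀ λ₀ a b → λ₀ ℕ.≤ a → λ₀ ℕ.≤ b → 2 ℕ.* λ₀ ℕ.≤ a ℕ.+ b
  2*λ≤ λ₀ a b λ≤a λ≤b =
    subst (ℕ._≤ a ℕ.+ b) (cong (λ₀ ℕ.+_) (sym (ℕP.+-identityʳ λ₀))) (ℕP.+-mono-≤ λ≤a λ≤b)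

  -- A conformal sign vector u of v splits ‖v‖₁ = ‖u‖₁ + ‖v - u‖₁; both parts would have norm ≥ λ.
  supportMinimal-of-norm1<2λ : ∀ {n m} (A : Matrix n m) → TotallyUnimodular A → (λ₀ : ℕ) → IsLambda A λ₀ →
    ∀ v → InL A v → NonZero v → norm1 v ℕ.< 2 ℕ.* λ₀ → SupportMinimal A v
  supportMinimal-of-norm1<2λ {m = m} A tu λ₀ (_ , λ-min) v vL v≢0 small
                             (w , wL , w≢0 , w⊆v , j , vj≢0 , wj≡0) =
    conformal-supportMinimal A v vL v≢0 v-equals-sign-vector
    where
    v-equals-sign-vector : ¬ (∃ λ u → InL A u × NonZero u × SupportMinimal A u × Conformal u v)
    v-equals-sign-vector (u₀ , u₀L , u₀≢0 , u₀-min , u₀⊑v) =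
      SupportMinimal-signum A u₀ u₀-min
        (w , wL , w≢0 , (λ i wi≢0 → subst (_≢ + 0) (v≗u i) (w⊆v i wi≢0)) ,
         j , subst (_≢ + 0) (v≗u j) vj≢0 , wj≡0)
      where
      u d : Vector m
      u = signum ∘ u₀
      d i = v i - u i
      uL : InL A u
      uL = signum-kernel A tu u₀ u₀L u₀≢0 u₀-min
      u≢0 : NonZero u
      u≢0 u≡0 = u₀≢0 (λ i → signum≡0⇒≡0 (u₀ i) (u≡0 i))
      dL : InL A d
      dL = InL-cong A (λ i → + 1 * v i + - + 1 * u i)
        (λ i → cong₂ _+_ (ℤP.*-identityˡ (v i)) (ℤP.-1*i≡-i (u i)))
        (InL-lincomb A v u vL uL (+ 1) (- + 1))
      split : norm1 u ℕ.+ norm1 d ≡ norm1 v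
      split = trans (sym (sumℕ-+ (λ i → ∣ u i ∣) (λ i → ∣ d i ∣)))
                    (sumℕ-cong (λ i → ∣signum∣+∣b-signum∣ (u₀ i) (v i) (u₀⊑v i)))
      d≡0 : ∀ i → d i ≡ + 0
      d≡0 = decidable-stable (FinP.all? (λ i → d i ℤP.≟ + 0)) λ d≢0 →
        ℕP.<⇒≱ small (subst (2 ℕ.* λ₀ ℕ.≤_) split (2*λ≤ λ₀ _ _ (λ-min u uL u≢0) (λ-min d dL d≢0)))
      v≗u : ∀ i → v i ≡ u i
      v≗u i = ℤP.i-j≡0⇒i≡j (v i) (u i) (d≡0 i)

  gcdVec-∣ : ∀ {m} (v : Vector m) j → gcdVec v ∣ ∣ v j ∣
  gcdVec-∣ {suc m} v zero    = gcd[m,n]∣m ∣ v zero ∣ (gcdVec (v ∘ suc))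
  gcdVec-∣ {suc m} v (suc j) = ∣-trans (gcd[m,n]∣n ∣ v zero ∣ (gcdVec (v ∘ suc))) (gcdVec-∣ (v ∘ suc) j)

  gcdVec≡0⇒≡0 : ∀ {m} (v : Vector m) → gcdVec v ≡ 0 → ∀ j → v j ≡ + 0
  gcdVec≡0⇒≡0 {suc m} v gcd≡0 zero    = ℤP.∣i∣≡0⇒i≡0 (gcd[m,n]≡0⇒m≡0 gcd≡0)
  gcdVec≡0⇒≡0 {suc m} v gcd≡0 (suc j) = gcdVec≡0⇒≡0 (v ∘ suc) (gcd[m,n]≡0⇒n≡0 ∣ v zero ∣ gcd≡0) j

  kernel-divide : ∀ {n m} (A : Matrix n m) (v : Vector m) (g : ℕ) → g ≢ 0 → (∀ j → g ∣ ∣ v j ∣) →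
    InL A v → NonZero v → ∃ λ w → InL A w × NonZero w × norm1 v ≡ g ℕ.* norm1 w
  kernel-divide {m = m} A v g g≢0 g∣v vL v≢0 = w , wL , w≢0 , norm-v
    where
    g∣ᵤv : ∀ j → + g Signed.∣ v j
    g∣ᵤv j = Signed.∣ᵤ⇒∣ (g∣v j)
    w : Vector m
    w j = Signed.quotient (g∣ᵤv j)
    v≡w*g : ∀ j → v j ≡ w j * + g
    v≡w*g j = Signed._∣_.equality (g∣ᵤv j)
    wL : InL A w
    wL = InL-cancel A w (+ g) (g≢0 ∘ ℤP.+-injective)
      (InL-cong A v (λ j → trans (v≡w*g j) (ℤP.*-comm (w j) (+ g))) vL)
    w≢0 : NonZero w
    w≢0 w≡0 = v≢0 (λ j → trans (v≡w*g j) (cong (_* + g) (w≡0 j)))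
    norm-v : norm1 v ≡ g ℕ.* norm1 w
    norm-v = trans (sumℕ-cong λ j → trans (cong ∣_∣ (v≡w*g j))
                                          (trans (ℤP.abs-* (w j) (+ g)) (ℕP.*-comm ∣ w j ∣ g)))
                   (sumℕ-*ˡ g (λ j → ∣ w j ∣))

  gcdVec≡1-of-norm1<2λ : ∀ {n m} (A : Matrix n m) (λ₀ : ℕ) → IsLambda A λ₀ →
    ∀ v → InL A v → NonZero v → norm1 v ℕ.< 2 ℕ.* λ₀ → gcdVec v ≡ 1
  gcdVec≡1-of-norm1<2λ A λ₀ (_ , λ-min) v vL v≢0 small with gcdVec v in gcd≡
  ... | zero         = ⊥-elim (v≢0 (gcdVec≡0⇒≡0 v gcd≡))
  ... | suc zero     = refl
  ... | suc (suc g′)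
    with kernel-divide A v (2 ℕ.+ g′) (λ ()) (λ j → subst (_∣ ∣ v j ∣) gcd≡ (gcdVec-∣ v j)) vL v≢0
  ...   | w , wL , w≢0 , norm-v = ⊥-elim (ℕP.<⇒≱ small (begin
    2 ℕ.* λ₀               ≤⟨ ℕP.*-monoʳ-≤ 2 (λ-min w wL w≢0) ⟩
    2 ℕ.* norm1 w          ≤⟨ ℕP.*-monoˡ-≤ (norm1 w) (ℕP.m≤m+n 2 g′) ⟩
    (2 ℕ.+ g′) ℕ.* norm1 w ≡⟨ sym norm-v ⟩
    norm1 v                ∎))
    where open ℕP.≤-Reasoning

-- ℤ's _*_ is only in scope inside TUCircuits, so that _*_ in the statement below is ℕ's.
open TUCircuits using (supportMinimal-of-norm1<2λ; gcdVec≡1-of-norm1<2λ)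
open import Data.Nat using (ℕ; _<_; _*_)

lemma4p6 : ∀ {n m} (A : Matrix n m) → TotallyUnimodular A →
    (λ₀ : ℕ) → IsLambda A λ₀ →
    ∀ (v : Vector m) → InL A v → NonZero v → norm1 v < 2 * λ₀ →
    IsCircuit A v
lemma4p6 A tu λ₀ isλ v vL v≢0 small =
  vL , supportMinimal-of-norm1<2λ A tu λ₀ isλ v vL v≢0 small
     , gcdVec≡1-of-norm1<2λ A λ₀ isλ v vL v≢0 small
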